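{- Let $n,r$ be integers with $n\geq r+1\geq 2$ and set $m=n-r$. Then $$\varphi\big(p_n^{(r)}\big)=\frac{1-q^r}{r!}\,q^{\binom{r}{2}}\,\Delta_m(q^r),$$ where $\Delta_m(q^r)$ is the determinant of the $m\times m$ matrix $(A_{i,j})_{1\leq i,j\leq m}$ with $A_{i,1}=[i]_{q^r}\,\varepsilon_i$ and $A_{i,j}=\varepsilon_{i-j+1}$ for $j\geq 2$, where $\varepsilon_k=q^{\binom{k}{2}}/k!$ for $k\geq0$ and $\varepsilon_k=0$ for $k<0$, and $[i]_{q^r}=1+q^r+q^{2r}+\dots+q^{(i-1)r}$.
   Context: Let $\Lambda$ be the ring of symmetric functions in infinitely many variables with coefficients in $\mathbb{Q}(q)$; $e_n$ are the elementary symmetric functions and $m_\lambda$ the monomial symmetric functions. For $n\geq r\geq 1$, $p_n^{(r)}=\sum m_\lambda$ over all partitions $\lambda$ of $n$ with exactly $r$ parts. Since $e_1,e_2,\dots$ are algebraically independent generators of $\Lambda$, there is a unique $\mathbb{Q}(q)$-algebra homomorphism $\varphi:\Lambda\to\mathbb{Q}(q)$ with $\varphi(e_n)=q^{\binom{n}{2}}/n!$ for all $n\geq1$ (the specialization in which $\sum_n e_nt^n$ becomes $\sum_{n\geq0}q^{\binom n2}t^n/n!$). -}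

module Defs where

open import Data.Nat as ℕ using (ℕ; zero; suc; _∸_; _!)
open import Data.Nat.Properties using (_!≢0; ≤-decTotalOrder)
open import Data.Nat.Combinatorics using (_C_)
open import Data.Integer as ℤ using (ℤ; +_; -[1+_])
open import Data.Rational as ℚ using (ℚ; 0ℚ; 1ℚ; _+_; _*_; _-_; -_)
open import Data.Fin as Fin using (Fin; toℕ; punchIn)
open import Data.Vec as Vec using (Vec; []; _∷_; toList)
open import Data.List as List using (List; []; _∷_; map; concatMap; filter; upTo; allFin; replicate; length; _++_; [_])
open import Data.List.Properties using (≡-dec)
open import Data.Product using (_×_; _,_)
open import Data.Bool using (if_then_else_)
open import Relation.Nullary.Decidable using (⌊_⌋)
open import Data.Nat.ListAction using () renaming (sum to sumℕ)
open import Data.List.Sort.InsertionSort ≤-decTotalOrder using (sort)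

infixr 8 _^ℚ_
_^ℚ_ : ℚ → ℕ → ℚ
x ^ℚ zero  = 1ℚ
x ^ℚ suc k = x * (x ^ℚ k)

sumℚ : List ℚ → ℚ
sumℚ = List.foldr _+_ 0ℚ

prodℚ : List ℚ → ℚ
prodℚ = List.foldr _*_ 1ℚ

invFact : ℕ → ℚ
invFact k = (+ 1 ℚ./ (k !)) {{k !≢0}}

compositions : (N d : ℕ) → List (Vec ℕ N)
compositions zero zero    = [ [] ]
compositions zero (suc d) = []
compositions (suc N) d =
  concatMap (λ a → map (a ∷_) (compositions N (d ∸ a))) (upTo (suc d))

monomial : ∀ {N} → Vec ℚ N → Vec ℕ N → ℚ
monomial []       []       = 1ℚ
monomial (x ∷ xs) (a ∷ as) = (x ^ℚ a) * monomial xs as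

-- A partition is a list of positive parts (weakly decreasing).
-- m_λ(x) = Σ x^α over all α ∈ ℕ^N that are rearrangements of
-- λ padded with zeros (i.e. the distinct permutations of λ).
m : List ℕ → ∀ {N} → Vec ℚ N → ℚ
m λp {N} x =
  sumℚ (map (monomial x)
    (filter (λ α → ≡-dec ℕ._≟_ (sort (toList α))
                                 (sort (λp ++ replicate (N ∸ length λp) 0)))
            (compositions N (sumℕ λp))))

-- partitions of n with all parts ≤ k (fuel f, f ≥ n suffices)
partsBounded : (f k n : ℕ) → List (List ℕ)
partsBounded zero    k zero    = [ [] ]
partsBounded zero    k (suc n) = []
partsBounded (suc f) k zero    = [ [] ]
partsBounded (suc f) k (suc n) =
  concatMap (λ j → map (j ∷_) (partsBounded f j (suc n ∸ j)))
            (filter (λ j → j ℕ.≤? k) (List.drop 1 (upTo (suc (suc n)))))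

partitions : ℕ → List (List ℕ)
partitions n = partsBounded n n n

e : ℕ → ∀ {N} → Vec ℚ N → ℚ
e k x = m (replicate k 1) x

p : (n r : ℕ) → ∀ {N} → Vec ℚ N → ℚ
p n r x = sumℚ (map (λ λp → m λp x)
                    (filter (λ λp → length λp ℕ.≟ r) (partitions n)))

-- Polynomials in the variables y₁,…,y_n (y_j stands for e_j),
-- with coefficients in ℚ: a list of (coefficient, exponent vector).

Poly : ℕ → Set
Poly n = List (ℚ × Vec ℕ n)

evalPoly : ∀ {n} → Poly n → Vec ℚ n → ℚ
evalPoly P y = sumℚ (map (λ { (c , α) → c * monomial y α }) P)

eVec : (n : ℕ) → ∀ {N} → Vec ℚ N → Vec ℚ n
eVec n x = Vec.tabulate (λ j → e (suc (toℕ j)) x)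

ε : ℕ → ℚ → ℚ
ε k q = (q ^ℚ (k C 2)) * invFact k

εℤ : ℤ → ℚ → ℚ
εℤ (+ k)    q = ε k q
εℤ -[1+ _ ] q = 0ℚ

εVec : (n : ℕ) → ℚ → Vec ℚ n
εVec n q = Vec.tabulate (λ j → ε (suc (toℕ j)) q)

qInt : ℕ → ℚ → ℚ
qInt i t = sumℚ (map (t ^ℚ_) (upTo i))

sign : ℕ → ℚ
sign zero    = 1ℚ
sign (suc k) = - sign k

det : (k : ℕ) → (Fin k → Fin k → ℚ) → ℚ
det zero    A = 1ℚ
det (suc k) A = sumℚ (map (λ j → sign (toℕ j) * A Fin.zero j
                                   * det k (λ i l → A (Fin.suc i) (punchIn j l)))
                          (allFin (suc k)))

-- the matrix A (0-based indices; i₁ = i+1, j₁ = j+1 are the 1-based ones):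
--   A_{i₁,1} = [i₁]_{q^r} ε_{i₁},   A_{i₁,j₁} = ε_{i₁ - j₁ + 1}  (j₁ ≥ 2)
matA : (k r : ℕ) → ℚ → Fin k → Fin k → ℚ
matA k r q i Fin.zero    = qInt (suc (toℕ i)) (q ^ℚ r) * ε (suc (toℕ i)) q
matA k r q i (Fin.suc j) =
  εℤ ((+ suc (toℕ i)) ℤ.+ (+ 1) ℤ.- (+ suc (toℕ (Fin.suc j)))) q

Δ : (k r : ℕ) → ℚ → ℚ
Δ k r q = det k (matA k r q)

-- Let E(t) = Σ eₖ tᵏ and H(t) = Σ hₖ tᵏ = 1 / E(−t). Grouping the monomials of degree n by the
-- number r of variables they involve gives Σᵣ p_n^{(r)} sʳ = [tⁿ] E((s − 1) t) H(t), that is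
-- p_n^{(r)} = Σₖ C(k, r) (−1)^{k−r} eₖ h_{n−k} =: Q_r(e)_n, so the hypothesis says P(e₁, …, e_n) = Q_r(e)_n
-- at every point x. By Newton's identities both sides are polynomials in the power sums p₁, …, p_n,
-- and their difference vanishes on all power-sum vectors, hence everywhere: m copies of a point s
-- contribute m (sᵏ)ₖ, so vanishing for all m ≥ 1 gives vanishing along every multiple c (sᵏ)ₖ; and
-- tʲ (sᵏ)ₖ is polynomial in s, equals s^{−j} (sᵏ)ₖ up to terms of degree below j, and is the j-th unit
-- vector at s = 0, which by induction on j reaches every vector. Thus P(y₁, …, y_n) = Q_r(y)_n for every
-- series y with y₀ = 1, in particular for y = ε. There C(r + j, r) ε_{r+j} = ε_r ε_j q^{rj}, so
-- Q_r(ε)_{r+m} = ε_r Σⱼ (−1)ʲ εⱼ q^{rj} h_{m−j}; for m ≥ 1 the factor 1 − q^r splits off, and what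
-- remains is the Laplace expansion of Δ_m(q^r) along its first row.

module Submission where

module ℚ-Ring where

  open import Data.Rational using (0ℚ)
  open import Data.Rational.Properties using (+-*-commutativeRing; _≟_)
  open import Level using (0ℓ)
  open import Relation.Nullary.Decidable using (dec⇒maybe)
  open import Tactic.RingSolver.Core.AlmostCommutativeRing using (AlmostCommutativeRing; fromCommutativeRing)

  ℚ-ring : AlmostCommutativeRing 0ℓ 0ℓ
  ℚ-ring = fromCommutativeRing +-*-commutativeRing (λ x → dec⇒maybe (0ℚ ≟ x))

module Series where

  open ℚ-Ring
  open import Defs using (_^ℚ_)
  open import Data.Nat using (ℕ; zero; suc; _≤_; _<_; _∸_; z≤n; s≤s)
  open import Data.Nat.Properties using (≤-refl; m≤n⇒m≤1+n)
  open import Data.Rational using (ℚ; 0ℚ; 1ℚ; _+_; _*_; -_)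
  open import Data.Rational.Properties
    using (+-identityˡ; +-identityʳ; *-identityˡ; *-zeroˡ; *-zeroʳ; *-assoc; *-comm; *-distribʳ-+)
  open import Data.Empty using (⊥-elim)
  open import Relation.Binary.PropositionalEquality
  open import Tactic.RingSolver using (solve-∀)
  open ≡-Reasoning

  -- Σₖ f k tᵏ; shift multiplies by t and _⊛_ is the Cauchy product.
  Series : Set
  Series = ℕ → ℚ

  infixl 6 _⊕_
  infixr 7 _⋆_
  infixl 7 _⊛_

  _⊕_ : Series → Series → Series
  (f ⊕ g) k = f k + g k

  _⋆_ : ℚ → Series → Series
  (c ⋆ f) k = c * f k

  𝟘 : Series
  𝟘 _ = 0ℚ

  𝟙 : Series
  𝟙 zero    = 1ℚ
  𝟙 (suc _) = 0ℚ

  shift : Series → Series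
  shift f zero    = 0ℚ
  shift f (suc k) = f k

  tail : Series → Series
  tail f k = f (suc k)

  _⊛_ : Series → Series → Series
  (f ⊛ g) zero    = f 0 * g 0
  (f ⊛ g) (suc n) = f 0 * g (suc n) + (tail f ⊛ g) n

  ⊛-local : ∀ n {f f′ g g′} → (∀ i → i ≤ n → f i ≡ f′ i) → (∀ i → i ≤ n → g i ≡ g′ i) →
            (f ⊛ g) n ≡ (f′ ⊛ g′) n
  ⊛-local zero    hf hg = cong₂ _*_ (hf 0 z≤n) (hg 0 z≤n)
  ⊛-local (suc n) hf hg = cong₂ _+_ (cong₂ _*_ (hf 0 z≤n) (hg (suc n) ≤-refl))
    (⊛-local n (λ i i≤n → hf (suc i) (s≤s i≤n)) (λ i i≤n → hg i (m≤n⇒m≤1+n i≤n)))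

  ⊛-cong : ∀ {f f′ g g′} → f ≗ f′ → g ≗ g′ → f ⊛ g ≗ f′ ⊛ g′
  ⊛-cong hf hg n = ⊛-local n (λ i _ → hf i) (λ i _ → hg i)

  ⊛-congˡ : ∀ {f f′} g → f ≗ f′ → f ⊛ g ≗ f′ ⊛ g
  ⊛-congˡ g hf = ⊛-cong hf (λ _ → refl)

  ⊛-congʳ : ∀ f {g g′} → g ≗ g′ → f ⊛ g ≗ f ⊛ g′
  ⊛-congʳ f hg = ⊛-cong (λ _ → refl) hg

  shift-cong : ∀ {f g} → f ≗ g → shift f ≗ shift g
  shift-cong h zero    = refl
  shift-cong h (suc k) = h k

  private
    0*a+b≡b : ∀ a b → 0ℚ * a + b ≡ b
    0*a+b≡b = solve-∀ ℚ-ring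

  ⊛-zeroˡ : ∀ g → 𝟘 ⊛ g ≗ 𝟘
  ⊛-zeroˡ g zero    = *-zeroˡ (g 0)
  ⊛-zeroˡ g (suc n) = trans (0*a+b≡b (g (suc n)) _) (⊛-zeroˡ g n)

  ⊛-identityˡ : ∀ g → 𝟙 ⊛ g ≗ g
  ⊛-identityˡ g zero    = *-identityˡ (g 0)
  ⊛-identityˡ g (suc n) = trans (cong₂ _+_ (*-identityˡ (g (suc n))) (⊛-zeroˡ g n)) (+-identityʳ _)

  ⊛-shiftˡ : ∀ f g → shift f ⊛ g ≗ shift (f ⊛ g)
  ⊛-shiftˡ f g zero    = *-zeroˡ (g 0)
  ⊛-shiftˡ f g (suc n) = 0*a+b≡b (g (suc n)) _

  ⊛-distribʳ-⊕ : ∀ f f′ g → (f ⊕ f′) ⊛ g ≗ f ⊛ g ⊕ f′ ⊛ g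
  ⊛-distribʳ-⊕ f f′ g zero    = *-distribʳ-+ (g 0) (f 0) (f′ 0)
  ⊛-distribʳ-⊕ f f′ g (suc n) =
    trans (cong ((f 0 + f′ 0) * g (suc n) +_) (⊛-distribʳ-⊕ (tail f) (tail f′) g n))
          (interchange (f 0) (f′ 0) (g (suc n)) _ _)
    where
    interchange : ∀ a b c d e → (a + b) * c + (d + e) ≡ (a * c + d) + (b * c + e)
    interchange = solve-∀ ℚ-ring

  ⊛-⋆ˡ : ∀ c f g → (c ⋆ f) ⊛ g ≗ c ⋆ (f ⊛ g)
  ⊛-⋆ˡ c f g zero    = *-assoc c (f 0) (g 0)
  ⊛-⋆ˡ c f g (suc n) =
    trans (cong (c * f 0 * g (suc n) +_) (⊛-⋆ˡ c (tail f) g n)) (factor c (f 0) (g (suc n)) _)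
    where
    factor : ∀ a b d e → a * b * d + a * e ≡ a * (b * d + e)
    factor = solve-∀ ℚ-ring

  ⊛-comm : ∀ f g → f ⊛ g ≗ g ⊛ f
  ⊛-comm f g zero          = *-comm (f 0) (g 0)
  ⊛-comm f g (suc zero)    = swap (f 0) (g 0) (f 1) (g 1)
    where
    swap : ∀ a b c d → a * d + c * b ≡ b * c + d * a
    swap = solve-∀ ℚ-ring
  ⊛-comm f g (suc (suc n)) = begin
    f 0 * g (suc (suc n)) + (tail f ⊛ g) (suc n)
      ≡⟨ cong (f 0 * g (suc (suc n)) +_) (⊛-comm (tail f) g (suc n)) ⟩
    f 0 * g (suc (suc n)) + (g 0 * f (suc (suc n)) + (tail g ⊛ tail f) n)
      ≡⟨ cong (λ z → f 0 * g (suc (suc n)) + (g 0 * f (suc (suc n)) + z)) (⊛-comm (tail g) (tail f) n) ⟩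
    f 0 * g (suc (suc n)) + (g 0 * f (suc (suc n)) + (tail f ⊛ tail g) n)
      ≡⟨ left-comm (f 0 * g (suc (suc n))) (g 0 * f (suc (suc n))) _ ⟩
    g 0 * f (suc (suc n)) + (f 0 * g (suc (suc n)) + (tail f ⊛ tail g) n)
      ≡⟨ cong (g 0 * f (suc (suc n)) +_) (⊛-comm f (tail g) (suc n)) ⟩
    g 0 * f (suc (suc n)) + (tail g ⊛ f) (suc n) ∎
    where
    left-comm : ∀ a b c → a + (b + c) ≡ b + (a + c)
    left-comm = solve-∀ ℚ-ring

  ⊛-zeroʳ : ∀ f → f ⊛ 𝟘 ≗ 𝟘
  ⊛-zeroʳ f k = trans (⊛-comm f 𝟘 k) (⊛-zeroˡ f k)

  ⊛-identityʳ : ∀ f → f ⊛ 𝟙 ≗ f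
  ⊛-identityʳ f k = trans (⊛-comm f 𝟙 k) (⊛-identityˡ f k)

  ⊛-unfoldˡ : ∀ f g → f ⊛ g ≗ f 0 ⋆ g ⊕ shift (tail f ⊛ g)
  ⊛-unfoldˡ f g zero    = sym (+-identityʳ _)
  ⊛-unfoldˡ f g (suc n) = refl

  ⊛-assoc : ∀ f g h → (f ⊛ g) ⊛ h ≗ f ⊛ (g ⊛ h)
  ⊛-assoc f g h k = begin
    ((f ⊛ g) ⊛ h) k
      ≡⟨ ⊛-congˡ h (⊛-unfoldˡ f g) k ⟩
    ((f 0 ⋆ g ⊕ shift (tail f ⊛ g)) ⊛ h) k
      ≡⟨ ⊛-distribʳ-⊕ (f 0 ⋆ g) (shift (tail f ⊛ g)) h k ⟩
    ((f 0 ⋆ g) ⊛ h) k + (shift (tail f ⊛ g) ⊛ h) k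
      ≡⟨ cong₂ _+_ (⊛-⋆ˡ (f 0) g h k) (⊛-shiftˡ (tail f ⊛ g) h k) ⟩
    f 0 * (g ⊛ h) k + shift ((tail f ⊛ g) ⊛ h) k
      ≡⟨ fold k ⟩
    (f ⊛ (g ⊛ h)) k ∎
    where
    fold : ∀ k → f 0 * (g ⊛ h) k + shift ((tail f ⊛ g) ⊛ h) k ≡ (f ⊛ (g ⊛ h)) k
    fold zero    = +-identityʳ _
    fold (suc n) = cong (f 0 * (g ⊛ h) (suc n) +_) (⊛-assoc (tail f) g h n)

  ⋆shift-⊛ : ∀ c f g → (c ⋆ shift f) ⊛ g ≗ c ⋆ shift (f ⊛ g)
  ⋆shift-⊛ c f g k = trans (⊛-⋆ˡ c (shift f) g k) (cong (c *_) (⊛-shiftˡ f g k))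

  ⊛-⊕⋆shiftˡ : ∀ a f g → (f ⊕ a ⋆ shift f) ⊛ g ≗ f ⊛ g ⊕ a ⋆ shift (f ⊛ g)
  ⊛-⊕⋆shiftˡ a f g k = trans (⊛-distribʳ-⊕ f (a ⋆ shift f) g k) (cong ((f ⊛ g) k +_) (⋆shift-⊛ a f g k))

  ⊛-⊕⋆shiftʳ : ∀ a f g → f ⊛ (g ⊕ a ⋆ shift g) ≗ f ⊛ g ⊕ a ⋆ shift (f ⊛ g)
  ⊛-⊕⋆shiftʳ a f g k = begin
    (f ⊛ (g ⊕ a ⋆ shift g)) k ≡⟨ ⊛-comm f _ k ⟩
    ((g ⊕ a ⋆ shift g) ⊛ f) k ≡⟨ ⊛-⊕⋆shiftˡ a g f k ⟩
    (g ⊛ f) k + a * shift (g ⊛ f) k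
      ≡⟨ cong₂ (λ u v → u + a * v) (⊛-comm g f k) (shift-cong (⊛-comm g f) k) ⟩
    (f ⊛ g) k + a * shift (f ⊛ g) k ∎

  powers : ℚ → Series
  powers a k = a ^ℚ k

  powers-inverse : ∀ a → powers a ⊕ (- a) ⋆ shift (powers a) ≗ 𝟙
  powers-inverse a zero    = trans (cong (1ℚ +_) (*-zeroʳ (- a))) (+-identityʳ 1ℚ)
  powers-inverse a (suc k) = cancel a (a ^ℚ k)
    where
    cancel : ∀ a b → a * b + (- a) * b ≡ 0ℚ
    cancel = solve-∀ ℚ-ring

  powers-zero : powers 0ℚ ≗ 𝟙
  powers-zero zero    = refl
  powers-zero (suc k) = *-zeroˡ (0ℚ ^ℚ k)

  ⊛-vanishingʳ : ∀ k f g → (∀ i → i ≤ k → g i ≡ 0ℚ) → (f ⊛ g) k ≡ 0ℚ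
  ⊛-vanishingʳ k f g g≡0 = trans (⊛-local k (λ _ _ → refl) g≡0) (⊛-zeroʳ f k)

  ⊛-leadingʳ : ∀ k f g → (∀ i → i < k → g i ≡ 0ℚ) → (f ⊛ g) k ≡ f 0 * g k
  ⊛-leadingʳ zero    f g _   = refl
  ⊛-leadingʳ (suc k) f g g≡0 =
    trans (cong (f 0 * g (suc k) +_) (⊛-vanishingʳ k (tail f) g (λ i i≤k → g≡0 i (s≤s i≤k)))) (+-identityʳ _)

  shiftN : ℕ → Series → Series
  shiftN zero    f = f
  shiftN (suc j) f = shift (shiftN j f)

  shiftN-cong : ∀ j {f g} → f ≗ g → shiftN j f ≗ shiftN j g
  shiftN-cong zero    f≗g = f≗g
  shiftN-cong (suc j) f≗g = shift-cong (shiftN-cong j f≗g)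

  shiftN-at : ∀ j f {k} → j ≤ k → shiftN j f k ≡ f (k ∸ j)
  shiftN-at zero    f _         = refl
  shiftN-at (suc j) f (s≤s j≤k) = shiftN-at j f j≤k

  shiftN-below : ∀ j f {k} → k < j → shiftN j f k ≡ 0ℚ
  shiftN-below (suc j) f {zero}  _         = refl
  shiftN-below (suc j) f {suc k} (s≤s k<j) = shiftN-below j f k<j

  ⊛-shiftNˡ : ∀ j f g → shiftN j f ⊛ g ≗ shiftN j (f ⊛ g)
  ⊛-shiftNˡ zero    f g = λ _ → refl
  ⊛-shiftNˡ (suc j) f g k = trans (⊛-shiftˡ (shiftN j f) g k) (shift-cong (⊛-shiftNˡ j f g) k)

  δ : ℕ → Series
  δ j = shiftN j 𝟙

  δ-self : ∀ m → δ m m ≡ 1ℚ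
  δ-self zero    = refl
  δ-self (suc m) = δ-self m

  δ-other : ∀ m k → k ≢ m → δ m k ≡ 0ℚ
  δ-other zero    zero    k≢m = ⊥-elim (k≢m refl)
  δ-other zero    (suc k) _   = refl
  δ-other (suc m) zero    _   = refl
  δ-other (suc m) (suc k) k≢m = δ-other m k (λ eq → k≢m (cong suc eq))

module Arithmetic where

  open ℚ-Ring
  open import Defs using (_^ℚ_)
  open import Data.Nat as ℕ using (ℕ; zero; suc)
  open import Data.Rational as ℚ using (ℚ; 0ℚ; 1ℚ; _+_; _*_; 1/_)
  import Data.Rational.Properties as ℚ
  open import Relation.Binary.PropositionalEquality
  open import Tactic.RingSolver using (solve-∀)
  open ≡-Reasoning

  fromℕ : ℕ → ℚ
  fromℕ zero    = 0ℚ
  fromℕ (suc n) = 1ℚ + fromℕ n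

  fromℕ-+ : ∀ m n → fromℕ (m ℕ.+ n) ≡ fromℕ m + fromℕ n
  fromℕ-+ zero    n = sym (ℚ.+-identityˡ _)
  fromℕ-+ (suc m) n = trans (cong (1ℚ +_) (fromℕ-+ m n)) (sym (ℚ.+-assoc 1ℚ (fromℕ m) (fromℕ n)))

  fromℕ-* : ∀ m n → fromℕ (m ℕ.* n) ≡ fromℕ m * fromℕ n
  fromℕ-* zero    n = sym (ℚ.*-zeroˡ (fromℕ n))
  fromℕ-* (suc m) n =
    trans (fromℕ-+ n (m ℕ.* n)) (trans (cong (fromℕ n +_) (fromℕ-* m n)) (distrib (fromℕ n) (fromℕ m)))
    where
    distrib : ∀ a b → a + b * a ≡ (1ℚ + b) * a
    distrib = solve-∀ ℚ-ring

  fromℕ-nonNeg : ∀ n → 0ℚ ℚ.≤ fromℕ n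
  fromℕ-nonNeg zero    = ℚ.≤-refl
  fromℕ-nonNeg (suc n) = ℚ.+-mono-≤ (ℚ.nonNegative⁻¹ 1ℚ) (fromℕ-nonNeg n)

  fromℕ-suc≢0 : ∀ n → fromℕ (suc n) ≢ 0ℚ
  fromℕ-suc≢0 n eq = ℚ.<⇒≢ (ℚ.+-mono-<-≤ (ℚ.positive⁻¹ 1ℚ) (fromℕ-nonNeg n)) (sym eq)

  *-zero-cancelˡ : ∀ a x → a ≢ 0ℚ → a * x ≡ 0ℚ → x ≡ 0ℚ
  *-zero-cancelˡ a x a≢0 ax≡0 = begin
    x                ≡⟨ sym (ℚ.*-identityˡ x) ⟩
    1ℚ * x           ≡⟨ cong (_* x) (sym (ℚ.*-inverseˡ a)) ⟩
    (1/ a) * a * x   ≡⟨ ℚ.*-assoc (1/ a) a x ⟩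
    (1/ a) * (a * x) ≡⟨ cong ((1/ a) *_) ax≡0 ⟩
    (1/ a) * 0ℚ      ≡⟨ ℚ.*-zeroʳ (1/ a) ⟩
    0ℚ               ∎
    where instance _ = ℚ.≢-nonZero a≢0

  1/suc : ℕ → ℚ
  1/suc n = 1/ fromℕ (suc n)
    where instance _ = ℚ.≢-nonZero (fromℕ-suc≢0 n)

  1/suc-inverseˡ : ∀ n → 1/suc n * fromℕ (suc n) ≡ 1ℚ
  1/suc-inverseˡ n = ℚ.*-inverseˡ (fromℕ (suc n))
    where instance _ = ℚ.≢-nonZero (fromℕ-suc≢0 n)

  1/suc-solve : ∀ n x y → fromℕ (suc n) * x ≡ y → x ≡ 1/suc n * y
  1/suc-solve n x y eq = begin
    x                              ≡⟨ sym (ℚ.*-identityˡ x) ⟩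
    1ℚ * x                         ≡⟨ cong (_* x) (sym (1/suc-inverseˡ n)) ⟩
    1/suc n * fromℕ (suc n) * x    ≡⟨ ℚ.*-assoc (1/suc n) (fromℕ (suc n)) x ⟩
    1/suc n * (fromℕ (suc n) * x)  ≡⟨ cong (1/suc n *_) eq ⟩
    1/suc n * y                    ∎

  ^ℚ-+ : ∀ s a b → s ^ℚ (a ℕ.+ b) ≡ s ^ℚ a * s ^ℚ b
  ^ℚ-+ s zero    b = sym (ℚ.*-identityˡ _)
  ^ℚ-+ s (suc a) b = trans (cong (s *_) (^ℚ-+ s a b)) (sym (ℚ.*-assoc s (s ^ℚ a) (s ^ℚ b)))

  ^ℚ-inverse : ∀ x y → x * y ≡ 1ℚ → ∀ m → x ^ℚ m * y ^ℚ m ≡ 1ℚ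
  ^ℚ-inverse x y xy≡1 zero    = refl
  ^ℚ-inverse x y xy≡1 (suc m) = begin
    x * x ^ℚ m * (y * y ^ℚ m)       ≡⟨ interchange x y (x ^ℚ m) (y ^ℚ m) ⟩
    (x * y) * (x ^ℚ m * y ^ℚ m)     ≡⟨ cong₂ _*_ xy≡1 (^ℚ-inverse x y xy≡1 m) ⟩
    1ℚ * 1ℚ                         ∎
    where
    interchange : ∀ a b c d → a * c * (b * d) ≡ (a * b) * (c * d)
    interchange = solve-∀ ℚ-ring

  ^ℚ-* : ∀ s a b → s ^ℚ (a ℕ.* b) ≡ (s ^ℚ b) ^ℚ a
  ^ℚ-* s zero    b = refl
  ^ℚ-* s (suc a) b = trans (^ℚ-+ s b (a ℕ.* b)) (cong (s ^ℚ b *_) (^ℚ-* s a b))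

module PolynomialFunctions where

  open ℚ-Ring
  open Arithmetic
  open import Defs using (_^ℚ_)
  open import Data.Nat as ℕ using (ℕ; zero; suc; z≤n; s≤s)
  import Data.Nat.Properties as ℕ
  open import Data.Rational as ℚ using (ℚ; 0ℚ; 1ℚ; _+_; _*_; _-_; -_)
  import Data.Rational.Properties as ℚ
  open import Data.List using (List; []; _∷_; length; map)
  open import Data.List.Properties using (length-map)
  open import Data.Product using (Σ; _,_)
  open import Relation.Binary.PropositionalEquality
  open import Tactic.RingSolver using (solve-∀)
  open ≡-Reasoning

  eval : List ℚ → ℚ → ℚ
  eval []       s = 0ℚ
  eval (c ∷ cs) s = c + s * eval cs s

  infixl 6 _⊞_
  _⊞_ : List ℚ → List ℚ → List ℚ
  []       ⊞ ds       = ds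
  (c ∷ cs) ⊞ []       = c ∷ cs
  (c ∷ cs) ⊞ (d ∷ ds) = (c + d) ∷ (cs ⊞ ds)

  scale : ℚ → List ℚ → List ℚ
  scale a = map (a *_)

  infixl 7 _⊠_
  _⊠_ : List ℚ → List ℚ → List ℚ
  []       ⊠ ds = []
  (c ∷ cs) ⊠ ds = scale c ds ⊞ (0ℚ ∷ cs ⊠ ds)

  eval-⊞ : ∀ cs ds s → eval (cs ⊞ ds) s ≡ eval cs s + eval ds s
  eval-⊞ []       ds       s = sym (ℚ.+-identityˡ _)
  eval-⊞ (c ∷ cs) []       s = sym (ℚ.+-identityʳ _)
  eval-⊞ (c ∷ cs) (d ∷ ds) s =
    trans (cong (λ z → c + d + s * z) (eval-⊞ cs ds s)) (regroup c d s (eval cs s) (eval ds s))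
    where
    regroup : ∀ c d s a b → c + d + s * (a + b) ≡ c + s * a + (d + s * b)
    regroup = solve-∀ ℚ-ring

  eval-scale : ∀ a cs s → eval (scale a cs) s ≡ a * eval cs s
  eval-scale a []       s = sym (ℚ.*-zeroʳ a)
  eval-scale a (c ∷ cs) s =
    trans (cong (λ z → a * c + s * z) (eval-scale a cs s)) (factor a c s (eval cs s))
    where
    factor : ∀ a c s e → a * c + s * (a * e) ≡ a * (c + s * e)
    factor = solve-∀ ℚ-ring

  eval-⊠ : ∀ cs ds s → eval (cs ⊠ ds) s ≡ eval cs s * eval ds s
  eval-⊠ []       ds s = sym (ℚ.*-zeroˡ (eval ds s))
  eval-⊠ (c ∷ cs) ds s = begin
    eval (scale c ds ⊞ (0ℚ ∷ cs ⊠ ds)) s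
      ≡⟨ eval-⊞ (scale c ds) (0ℚ ∷ cs ⊠ ds) s ⟩
    eval (scale c ds) s + (0ℚ + s * eval (cs ⊠ ds) s)
      ≡⟨ cong₂ (λ u v → u + (0ℚ + s * v)) (eval-scale c ds s) (eval-⊠ cs ds s) ⟩
    c * eval ds s + (0ℚ + s * (eval cs s * eval ds s))
      ≡⟨ factor c s (eval cs s) (eval ds s) ⟩
    (c + s * eval cs s) * eval ds s ∎
    where
    factor : ∀ c s a b → c * b + (0ℚ + s * (a * b)) ≡ (c + s * a) * b
    factor = solve-∀ ℚ-ring

  IsPolynomial : (ℚ → ℚ) → Set
  IsPolynomial f = Σ (List ℚ) λ cs → ∀ s → f s ≡ eval cs s

  poly-const : ∀ c → IsPolynomial (λ _ → c)
  poly-const c = c ∷ [] , λ s → sym (trans (cong (c +_) (ℚ.*-zeroʳ s)) (ℚ.+-identityʳ c))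

  poly-id : IsPolynomial (λ s → s)
  poly-id = 0ℚ ∷ 1ℚ ∷ [] , λ s → sym (simplify s)
    where
    simplify : ∀ s → 0ℚ + s * (1ℚ + s * 0ℚ) ≡ s
    simplify = solve-∀ ℚ-ring

  poly-+ : ∀ {f g} → IsPolynomial f → IsPolynomial g → IsPolynomial (λ s → f s + g s)
  poly-+ (cs , f≗) (ds , g≗) = cs ⊞ ds , λ s → trans (cong₂ _+_ (f≗ s) (g≗ s)) (sym (eval-⊞ cs ds s))

  poly-* : ∀ {f g} → IsPolynomial f → IsPolynomial g → IsPolynomial (λ s → f s * g s)
  poly-* (cs , f≗) (ds , g≗) = cs ⊠ ds , λ s → trans (cong₂ _*_ (f≗ s) (g≗ s)) (sym (eval-⊠ cs ds s))

  poly-cong : ∀ {f g} → (∀ s → f s ≡ g s) → IsPolynomial f → IsPolynomial g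
  poly-cong f≗g (cs , f≗) = cs , λ s → trans (sym (f≗g s)) (f≗ s)

  poly-neg : ∀ {f} → IsPolynomial f → IsPolynomial (λ s → - f s)
  poly-neg p = poly-cong (λ s → -1*a≡-a _) (poly-* (poly-const (- 1ℚ)) p)
    where
    -1*a≡-a : ∀ a → (- 1ℚ) * a ≡ - a
    -1*a≡-a = solve-∀ ℚ-ring

  poly-^ : ∀ {f} → IsPolynomial f → ∀ k → IsPolynomial (λ s → f s ^ℚ k)
  poly-^ p zero    = poly-const 1ℚ
  poly-^ p (suc k) = poly-* p (poly-^ p k)

  quotient : List ℚ → ℚ → List ℚ
  quotient []       a = []
  quotient (c ∷ cs) a = cs ⊞ scale a (quotient cs a)

  eval-quotient : ∀ cs a s → eval cs s ≡ eval cs a + (s - a) * eval (quotient cs a) s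
  eval-quotient []       a s = sym (trans (cong (0ℚ +_) (ℚ.*-zeroʳ (s - a))) (ℚ.+-identityʳ 0ℚ))
  eval-quotient (c ∷ cs) a s = begin
    c + s * eval cs s
      ≡⟨ cong (λ z → c + s * z) (eval-quotient cs a s) ⟩
    c + s * (e + (s - a) * d)
      ≡⟨ regroup c s a e d ⟩
    c + a * e + (s - a) * ((e + (s - a) * d) + a * d)
      ≡⟨ cong (λ z → c + a * e + (s - a) * (z + a * d)) (sym (eval-quotient cs a s)) ⟩
    c + a * e + (s - a) * (eval cs s + a * d)
      ≡⟨ cong (λ z → c + a * e + (s - a) * (eval cs s + z)) (sym (eval-scale a (quotient cs a) s)) ⟩
    c + a * e + (s - a) * (eval cs s + eval (scale a (quotient cs a)) s)
      ≡⟨ cong (λ z → c + a * e + (s - a) * z) (sym (eval-⊞ cs (scale a (quotient cs a)) s)) ⟩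
    c + a * e + (s - a) * eval (cs ⊞ scale a (quotient cs a)) s ∎
    where
    e = eval cs a
    d = eval (quotient cs a) s
    regroup : ∀ c s a e d → c + s * (e + (s - a) * d) ≡ c + a * e + (s - a) * ((e + (s - a) * d) + a * d)
    regroup = solve-∀ ℚ-ring

  length-⊞ : ∀ cs ds → length (cs ⊞ ds) ≡ length cs ℕ.⊔ length ds
  length-⊞ []       ds       = refl
  length-⊞ (c ∷ cs) []       = refl
  length-⊞ (c ∷ cs) (d ∷ ds) = cong suc (length-⊞ cs ds)

  length-quotient : ∀ c cs a → length (quotient (c ∷ cs) a) ℕ.≤ length cs
  length-quotient c cs a
    rewrite length-⊞ cs (scale a (quotient cs a)) | length-map (a *_) (quotient cs a)
    = ℕ.⊔-lub ℕ.≤-refl (shorter cs)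
    where
    shorter : ∀ cs → length (quotient cs a) ℕ.≤ length cs
    shorter []       = z≤n
    shorter (d ∷ ds) = ℕ.m≤n⇒m≤1+n (length-quotient d ds a)

  private
    -- Divide by s − a at the first point a = o + 1: the quotient has fewer coefficients and
    -- still vanishes at o + 2, o + 3, ….
    vanishing-beyond : ∀ fuel cs → length cs ℕ.≤ fuel → ∀ o →
                       (∀ j → eval cs (fromℕ (suc j ℕ.+ o)) ≡ 0ℚ) → ∀ s → eval cs s ≡ 0ℚ
    vanishing-beyond fuel       []       _          o vanish s = refl
    vanishing-beyond (suc fuel) (c ∷ cs) (s≤s len≤) o vanish s = begin
      eval (c ∷ cs) s                      ≡⟨ eval-quotient (c ∷ cs) a s ⟩
      eval (c ∷ cs) a + (s - a) * eval q s ≡⟨ cong₂ (λ u v → u + (s - a) * v) (vanish 0) (q-zero s) ⟩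
      0ℚ + (s - a) * 0ℚ                    ≡⟨ 0+x*0≡0 (s - a) ⟩
      0ℚ                                   ∎
      where
      a = fromℕ (suc o)
      q = quotient (c ∷ cs) a
      0+x*0≡0 : ∀ x → 0ℚ + x * 0ℚ ≡ 0ℚ
      0+x*0≡0 = solve-∀ ℚ-ring
      x+y-y≡x : ∀ x y → x + y - y ≡ x
      x+y-y≡x = solve-∀ ℚ-ring
      q-vanish : ∀ j → eval q (fromℕ (suc j ℕ.+ suc o)) ≡ 0ℚ
      q-vanish j = *-zero-cancelˡ (b - a) (eval q b) b-a≢0 (begin
        (b - a) * eval q b                   ≡⟨ sym (ℚ.+-identityˡ _) ⟩
        0ℚ + (b - a) * eval q b              ≡⟨ cong (_+ (b - a) * eval q b) (sym (vanish 0)) ⟩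
        eval (c ∷ cs) a + (b - a) * eval q b ≡⟨ sym (eval-quotient (c ∷ cs) a b) ⟩
        eval (c ∷ cs) b                      ≡⟨ cong (λ n → eval (c ∷ cs) (fromℕ n)) (ℕ.+-suc (suc j) o) ⟩
        eval (c ∷ cs) (fromℕ (suc (suc j) ℕ.+ o)) ≡⟨ vanish (suc j) ⟩
        0ℚ                                   ∎)
        where
        b = fromℕ (suc j ℕ.+ suc o)
        b-a≢0 : b - a ≢ 0ℚ
        b-a≢0 eq = fromℕ-suc≢0 j (begin
          fromℕ (suc j)         ≡⟨ sym (x+y-y≡x (fromℕ (suc j)) a) ⟩
          fromℕ (suc j) + a - a ≡⟨ cong (_- a) (sym (fromℕ-+ (suc j) (suc o))) ⟩
          b - a                 ≡⟨ eq ⟩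
          0ℚ                    ∎)
      q-zero : ∀ s → eval q s ≡ 0ℚ
      q-zero = vanishing-beyond fuel q (ℕ.≤-trans (length-quotient c cs a) len≤) (suc o) q-vanish

  poly-vanishing : ∀ {f} → IsPolynomial f → (∀ k → f (fromℕ (suc k)) ≡ 0ℚ) → ∀ s → f s ≡ 0ℚ
  poly-vanishing {f} (cs , f≗) vanish s = trans (f≗ s)
    (vanishing-beyond (length cs) cs ℕ.≤-refl 0 vanish′ s)
    where
    vanish′ : ∀ j → eval cs (fromℕ (suc j ℕ.+ 0)) ≡ 0ℚ
    vanish′ j = trans (sym (f≗ _)) (subst (λ n → f (fromℕ (suc n)) ≡ 0ℚ) (sym (ℕ.+-identityʳ j)) (vanish j))

module Recurrence where

  open Series
  open PolynomialFunctions
  open import Data.Nat using (ℕ; zero; suc; _≤_; _<_; z≤n; s≤s)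
  open import Data.Nat.Properties using (≤-refl; ≤-trans; m≤n⇒m≤1+n)
  open import Data.Rational using (ℚ; 0ℚ; 1ℚ; _+_; _*_)
  open import Data.Rational.Properties using (+-identityʳ; *-comm)
  open import Data.List using (List; []; _∷_)
  open import Relation.Binary.PropositionalEquality
  open ≡-Reasoning

  module _ (c : ℕ → ℚ) (M : Series) where

    private
      dot : List ℚ → Series → ℚ
      dot []      N = 0ℚ
      dot (a ∷ l) N = a * N 0 + dot l (tail N)

      -- the values F k, F (k - 1), …, F 0 of the sequence being defined
      history : ℕ → List ℚ
      history zero    = 1ℚ ∷ []
      history (suc k) = c k * dot (history k) M ∷ history k

      head : List ℚ → ℚ
      head []      = 0ℚ
      head (a ∷ _) = a

    recurrence : Series
    recurrence k = head (history k)

    private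
      reversed : Series → ℕ → List ℚ
      reversed F zero    = F 0 ∷ []
      reversed F (suc k) = F (suc k) ∷ reversed F k

      history-reversed : ∀ k → history k ≡ reversed recurrence k
      history-reversed zero    = refl
      history-reversed (suc k) = cong (c k * dot (history k) M ∷_) (history-reversed k)

      dot-reversed : ∀ F N k → dot (reversed F k) N ≡ (N ⊛ F) k
      dot-reversed F N zero    = trans (+-identityʳ (F 0 * N 0)) (*-comm (F 0) (N 0))
      dot-reversed F N (suc k) = cong₂ _+_ (*-comm (F (suc k)) (N 0)) (dot-reversed F (tail N) k)

    recurrence-suc : ∀ k → recurrence (suc k) ≡ c k * (M ⊛ recurrence) k
    recurrence-suc k =
      cong (c k *_) (trans (cong (λ l → dot l M) (history-reversed k)) (dot-reversed recurrence M k))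

  recurrence-local : ∀ c M M′ n → (∀ i → i < n → M i ≡ M′ i) →
                     ∀ k → k ≤ n → recurrence c M k ≡ recurrence c M′ k
  recurrence-local c M M′ n          M≡ zero    _         = refl
  recurrence-local c M M′ (suc n) M≡ (suc k) (s≤s k≤n) = begin
    recurrence c M (suc k)        ≡⟨ recurrence-suc c M k ⟩
    c k * (M ⊛ recurrence c M) k  ≡⟨ cong (c k *_) (⊛-local k (λ i i≤k → M≡ i (s≤s (≤-trans i≤k k≤n)))
                                       (λ i i≤k → recurrence-local c M M′ n (λ j j<n → M≡ j (m≤n⇒m≤1+n j<n))
                                                     i (≤-trans i≤k k≤n))) ⟩
    c k * (M′ ⊛ recurrence c M′) k ≡⟨ sym (recurrence-suc c M′ k) ⟩
    recurrence c M′ (suc k)       ∎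

  recurrence-cong : ∀ c {M M′} → M ≗ M′ → recurrence c M ≗ recurrence c M′
  recurrence-cong c {M} {M′} M≗ k = recurrence-local c M M′ k (λ i _ → M≗ i) k ≤-refl

  recurrence-unique : ∀ c M F → F 0 ≡ 1ℚ → (∀ k → F (suc k) ≡ c k * (M ⊛ F) k) → F ≗ recurrence c M
  recurrence-unique c M F F0 Fsuc k = below k k ≤-refl
    where
    below : ∀ n k → k ≤ n → F k ≡ recurrence c M k
    below n       zero    _         = F0
    below (suc n) (suc k) (s≤s k≤n) = begin
      F (suc k)                    ≡⟨ Fsuc k ⟩
      c k * (M ⊛ F) k              ≡⟨ cong (c k *_) (⊛-local k (λ _ _ → refl) (λ i i≤k → below n i (≤-trans i≤k k≤n))) ⟩
      c k * (M ⊛ recurrence c M) k ≡⟨ sym (recurrence-suc c M k) ⟩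
      recurrence c M (suc k)       ∎

  ⊛-poly : ∀ n (f g : ℚ → Series) → (∀ i → i ≤ n → IsPolynomial (λ s → f s i)) →
           (∀ i → i ≤ n → IsPolynomial (λ s → g s i)) → IsPolynomial (λ s → (f s ⊛ g s) n)
  ⊛-poly zero    f g f-poly g-poly = poly-* (f-poly 0 z≤n) (g-poly 0 z≤n)
  ⊛-poly (suc n) f g f-poly g-poly = poly-+ (poly-* (f-poly 0 z≤n) (g-poly (suc n) ≤-refl))
    (⊛-poly n (λ s → tail (f s)) g (λ i i≤n → f-poly (suc i) (s≤s i≤n)) (λ i i≤n → g-poly i (m≤n⇒m≤1+n i≤n)))

  recurrence-poly : ∀ c (M : ℚ → Series) → (∀ i → IsPolynomial (λ s → M s i)) →
                    ∀ k → IsPolynomial (λ s → recurrence c (M s) k)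
  recurrence-poly c M M-poly k = below k k ≤-refl
    where
    below : ∀ n k → k ≤ n → IsPolynomial (λ s → recurrence c (M s) k)
    below n       zero    _         = poly-const 1ℚ
    below (suc n) (suc k) (s≤s k≤n) = poly-cong (λ s → sym (recurrence-suc c (M s) k))
      (poly-* (poly-const (c k))
              (⊛-poly k M (λ s → recurrence c (M s)) (λ i _ → M-poly i) (λ i i≤k → below n i (≤-trans i≤k k≤n))))

module Newton where

  open ℚ-Ring
  open Series
  open Arithmetic
  open Recurrence
  open import Defs using (sign; _^ℚ_)
  open import Data.Nat using (zero; suc)
  open import Data.Rational using (ℚ; 0ℚ; 1ℚ; _+_; _*_; -_)
  open import Data.Rational.Properties
    using (+-identityˡ; +-identityʳ; *-zeroˡ; *-zeroʳ; *-distribˡ-+)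
  open import Data.Vec using (Vec; []; _∷_; _++_; replicate)
  open import Relation.Binary.PropositionalEquality
  open import Tactic.RingSolver using (solve-∀)
  open ≡-Reasoning

  eSeries : ∀ {N} → Vec ℚ N → Series
  eSeries []       = 𝟙
  eSeries (a ∷ xs) = eSeries xs ⊕ a ⋆ shift (eSeries xs)

  powerSums : ∀ {N} → Vec ℚ N → Series
  powerSums []       = 𝟘
  powerSums (a ∷ xs) = powerSums xs ⊕ powers a

  altTail : Series → Series
  altTail p i = sign i * p (suc i)

  -- Newton's identities (k + 1) e_{k+1} = Σ_{i ≤ k} (−1)ⁱ p_{i+1} e_{k−i}.
  fromPowerSums : Series → Series
  fromPowerSums p = recurrence 1/suc (altTail p)

  eSeries-zero : ∀ {N} (x : Vec ℚ N) → eSeries x 0 ≡ 1ℚ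
  eSeries-zero []       = refl
  eSeries-zero (a ∷ xs) = trans (cong₂ _+_ (eSeries-zero xs) (*-zeroʳ a)) (+-identityʳ 1ℚ)

  powerSums-++ : ∀ {m l} (xs : Vec ℚ m) (ys : Vec ℚ l) → powerSums (xs ++ ys) ≗ powerSums xs ⊕ powerSums ys
  powerSums-++ []       ys k = sym (+-identityˡ (powerSums ys k))
  powerSums-++ (a ∷ xs) ys k = trans (cong (_+ a ^ℚ k) (powerSums-++ xs ys k)) (right-comm (powerSums xs k) _ _)
    where
    right-comm : ∀ u v w → u + v + w ≡ u + w + v
    right-comm = solve-∀ ℚ-ring

  powerSums-replicate : ∀ m s → powerSums (replicate m s) ≗ fromℕ m ⋆ powers s
  powerSums-replicate zero    s k = sym (*-zeroˡ (s ^ℚ k))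
  powerSums-replicate (suc m) s k = trans (cong (_+ s ^ℚ k) (powerSums-replicate m s k)) (factor (fromℕ m) (s ^ℚ k))
    where
    factor : ∀ u w → u * w + w ≡ (1ℚ + u) * w
    factor = solve-∀ ℚ-ring

  altTail-⊕ : ∀ f g → altTail (f ⊕ g) ≗ altTail f ⊕ altTail g
  altTail-⊕ f g i = *-distribˡ-+ (sign i) (f (suc i)) (g (suc i))

  altTail-powers-⊛ : ∀ a E → altTail (powers a) ⊛ (E ⊕ a ⋆ shift E) ≗ a ⋆ E
  altTail-powers-⊛ a E k = begin
    (m ⊛ (E ⊕ a ⋆ shift E)) k   ≡⟨ ⊛-⊕⋆shiftʳ a m E k ⟩
    (m ⊛ E) k + a * shift (m ⊛ E) k ≡⟨ sym (⊛-⊕⋆shiftˡ a m E k) ⟩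
    ((m ⊕ a ⋆ shift m) ⊛ E) k   ≡⟨ ⊛-congˡ E telescope k ⟩
    ((a ⋆ 𝟙) ⊛ E) k             ≡⟨ ⊛-⋆ˡ a 𝟙 E k ⟩
    a * (𝟙 ⊛ E) k               ≡⟨ cong (a *_) (⊛-identityˡ E k) ⟩
    a * E k                     ∎
    where
    m = altTail (powers a)
    telescope : m ⊕ a ⋆ shift m ≗ a ⋆ 𝟙
    telescope zero    = simplify a
      where
      simplify : ∀ a → 1ℚ * (a * 1ℚ) + a * 0ℚ ≡ a * 1ℚ
      simplify = solve-∀ ℚ-ring
    telescope (suc i) = cancel a (sign i) (a ^ℚ suc i)
      where
      cancel : ∀ a s b → (- s) * (a * b) + a * (s * b) ≡ a * 0ℚ
      cancel = solve-∀ ℚ-ring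

  newton-derivative : ∀ {N} (x : Vec ℚ N) k →
                      fromℕ k * eSeries x k ≡ shift (altTail (powerSums x) ⊛ eSeries x) k
  newton-derivative []       zero    = *-zeroˡ 1ℚ
  newton-derivative []       (suc k) = trans (*-zeroʳ (fromℕ (suc k)))
    (sym (trans (⊛-congˡ 𝟙 (λ i → *-zeroʳ (sign i)) k) (⊛-zeroˡ 𝟙 k)))
  newton-derivative (a ∷ xs) zero    = *-zeroˡ (eSeries (a ∷ xs) 0)
  newton-derivative (a ∷ xs) (suc k) = begin
    fromℕ (suc k) * (E (suc k) + a * E k)
      ≡⟨ expand (fromℕ k) (E (suc k)) a (E k) ⟩
    (fromℕ (suc k) * E (suc k) + a * (fromℕ k * E k)) + a * E k
      ≡⟨ cong₂ (λ u v → (u + a * v) + a * E k) (newton-derivative xs (suc k)) (newton-derivative xs k) ⟩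
    ((M ⊛ E) k + a * shift (M ⊛ E) k) + a * E k
      ≡⟨ cong₂ _+_ (sym (⊛-⊕⋆shiftʳ a M E k)) (sym (altTail-powers-⊛ a E k)) ⟩
    (M ⊛ E′) k + (altTail (powers a) ⊛ E′) k
      ≡⟨ sym (⊛-distribʳ-⊕ M (altTail (powers a)) E′ k) ⟩
    ((M ⊕ altTail (powers a)) ⊛ E′) k
      ≡⟨ ⊛-congˡ E′ (altTail-⊕ (powerSums xs) (powers a)) k ⟨
    (altTail (powerSums (a ∷ xs)) ⊛ E′) k ∎
    where
    E  = eSeries xs
    E′ = eSeries (a ∷ xs)
    M  = altTail (powerSums xs)
    expand : ∀ n e₁ a e₀ → (1ℚ + n) * (e₁ + a * e₀) ≡ ((1ℚ + n) * e₁ + a * (n * e₀)) + a * e₀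
    expand = solve-∀ ℚ-ring

  newton : ∀ {N} (x : Vec ℚ N) → fromPowerSums (powerSums x) ≗ eSeries x
  newton x k = sym (recurrence-unique 1/suc (altTail (powerSums x)) (eSeries x) (eSeries-zero x) step k)
    where
    step : ∀ k → eSeries x (suc k) ≡ 1/suc k * (altTail (powerSums x) ⊛ eSeries x) k
    step k = 1/suc-solve k _ _ (newton-derivative x (suc k))

module CompleteHomogeneous where

  open ℚ-Ring
  open Series
  open Arithmetic
  open Recurrence
  open Newton
  open import Defs using (sign)
  open import Data.Nat using (zero; suc)
  open import Data.Rational using (0ℚ; 1ℚ; _+_; _*_; _-_; -_)
  open import Data.Rational.Properties using (*-identityˡ; *-zeroʳ; +-identityʳ)
  open import Relation.Binary.PropositionalEquality
  open import Tactic.RingSolver using (solve-∀)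
  open ≡-Reasoning

  alternate : Series → Series
  alternate y k = sign k * y k

  -- h = 1 / E(−t), i.e. h_{k+1} = Σ_{i ≤ k} (−1)ⁱ y_{i+1} h_{k−i}.
  hSeries : Series → Series
  hSeries y = recurrence (λ _ → 1ℚ) (altTail y)

  hSeries-suc : ∀ y k → hSeries y (suc k) ≡ (altTail y ⊛ hSeries y) k
  hSeries-suc y k = trans (recurrence-suc (λ _ → 1ℚ) (altTail y) k) (*-identityˡ _)

  derivative : Series → Series
  derivative y k = fromℕ (suc k) * y (suc k)

  sign-involutive : ∀ i x → sign i * (sign i * x) ≡ x
  sign-involutive zero    x = trans (*-identityˡ _) (*-identityˡ x)
  sign-involutive (suc i) x = trans (neg-neg (sign i) x) (sign-involutive i x)
    where
    neg-neg : ∀ s x → (- s) * ((- s) * x) ≡ s * (s * x)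
    neg-neg = solve-∀ ℚ-ring

  alternate-⊛-suc : ∀ y W k → (alternate y ⊛ W) (suc k) ≡ y 0 * W (suc k) - (altTail y ⊛ W) k
  alternate-⊛-suc y W k = begin
    1ℚ * y 0 * W (suc k) + (tail (alternate y) ⊛ W) k
      ≡⟨ cong (1ℚ * y 0 * W (suc k) +_) (⊛-congˡ W tail-alternate k) ⟩
    1ℚ * y 0 * W (suc k) + (((- 1ℚ) ⋆ altTail y) ⊛ W) k
      ≡⟨ cong (1ℚ * y 0 * W (suc k) +_) (⊛-⋆ˡ (- 1ℚ) (altTail y) W k) ⟩
    1ℚ * y 0 * W (suc k) + (- 1ℚ) * (altTail y ⊛ W) k
      ≡⟨ simplify (y 0) (W (suc k)) _ ⟩
    y 0 * W (suc k) - (altTail y ⊛ W) k ∎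
    where
    tail-alternate : tail (alternate y) ≗ (- 1ℚ) ⋆ altTail y
    tail-alternate i = pull-sign (sign i) (y (suc i))
      where
      pull-sign : ∀ s b → (- s) * b ≡ (- 1ℚ) * (s * b)
      pull-sign = solve-∀ ℚ-ring
    simplify : ∀ a w c → 1ℚ * a * w + (- 1ℚ) * c ≡ a * w - c
    simplify = solve-∀ ℚ-ring

  hSeries-inverse : ∀ y → y 0 ≡ 1ℚ → alternate y ⊛ hSeries y ≗ 𝟙
  hSeries-inverse y y0≡1 zero    = cong (λ z → 1ℚ * z * 1ℚ) y0≡1
  hSeries-inverse y y0≡1 (suc k) = begin
    (alternate y ⊛ H) (suc k)         ≡⟨ alternate-⊛-suc y H k ⟩
    y 0 * H (suc k) - (altTail y ⊛ H) k
      ≡⟨ cong₂ (λ u v → u * v - (altTail y ⊛ H) k) y0≡1 (hSeries-suc y k) ⟩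
    1ℚ * (altTail y ⊛ H) k - (altTail y ⊛ H) k ≡⟨ cancel ((altTail y ⊛ H) k) ⟩
    0ℚ                                ∎
    where
    H = hSeries y
    cancel : ∀ c → 1ℚ * c - c ≡ 0ℚ
    cancel = solve-∀ ℚ-ring

  hSeries-unique : ∀ y W → y 0 ≡ 1ℚ → alternate y ⊛ W ≗ 𝟙 → W ≗ hSeries y
  hSeries-unique y W y0≡1 inverse = recurrence-unique (λ _ → 1ℚ) (altTail y) W W0≡1 Wsuc
    where
    W0≡1 : W 0 ≡ 1ℚ
    W0≡1 = trans (sym (simplify (W 0))) (trans (cong (λ z → 1ℚ * z * W 0) (sym y0≡1)) (inverse 0))
      where
      simplify : ∀ w → 1ℚ * 1ℚ * w ≡ w
      simplify = solve-∀ ℚ-ring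
    Wsuc : ∀ k → W (suc k) ≡ 1ℚ * (altTail y ⊛ W) k
    Wsuc k = begin
      W (suc k)                                       ≡⟨ rearrange (W (suc k)) c ⟩
      (1ℚ * W (suc k) - c) + 1ℚ * c                   ≡⟨ cong (λ z → (z * W (suc k) - c) + 1ℚ * c) (sym y0≡1) ⟩
      (y 0 * W (suc k) - c) + 1ℚ * c                  ≡⟨ cong (_+ 1ℚ * c) (sym (alternate-⊛-suc y W k)) ⟩
      (alternate y ⊛ W) (suc k) + 1ℚ * c              ≡⟨ cong (_+ 1ℚ * c) (inverse (suc k)) ⟩
      0ℚ + 1ℚ * c                                     ≡⟨ simplify c ⟩
      1ℚ * c                                          ∎
      where
      c = (altTail y ⊛ W) k
      rearrange : ∀ w c → w ≡ (1ℚ * w - c) + 1ℚ * c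
      rearrange = solve-∀ ℚ-ring
      simplify : ∀ c → 0ℚ + 1ℚ * c ≡ 1ℚ * c
      simplify = solve-∀ ℚ-ring

  hSeries-cong : ∀ {y y′} → y ≗ y′ → hSeries y ≗ hSeries y′
  hSeries-cong y≗ = recurrence-cong (λ _ → 1ℚ) (λ i → cong (sign i *_) (y≗ (suc i)))

  hSeries-𝟙 : hSeries 𝟙 ≗ 𝟙
  hSeries-𝟙 k = sym (hSeries-unique 𝟙 𝟙 refl (λ j → trans (⊛-congˡ 𝟙 alternate-𝟙 j) (⊛-identityʳ 𝟙 j)) k)
    where
    alternate-𝟙 : alternate 𝟙 ≗ 𝟙
    alternate-𝟙 zero    = refl
    alternate-𝟙 (suc k) = *-zeroʳ (sign (suc k))

  alternate-step : ∀ y a → alternate (y ⊕ a ⋆ shift y) ≗ alternate y ⊕ (- a) ⋆ shift (alternate y)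
  alternate-step y a zero    = distribute (y 0) a
    where
    distribute : ∀ b a → 1ℚ * (b + a * 0ℚ) ≡ 1ℚ * b + (- a) * 0ℚ
    distribute = solve-∀ ℚ-ring
  alternate-step y a (suc k) = distribute (sign k) (y (suc k)) a (y k)
    where
    distribute : ∀ s b a c → (- s) * (b + a * c) ≡ (- s) * b + (- a) * (s * c)
    distribute = solve-∀ ℚ-ring

  hSeries-step : ∀ y a → y 0 ≡ 1ℚ → hSeries (y ⊕ a ⋆ shift y) ≗ hSeries y ⊛ powers a
  hSeries-step y a y0≡1 k = sym (hSeries-unique (y ⊕ a ⋆ shift y) (H ⊛ G) y′0≡1 inverse k)
    where
    H = hSeries y
    G = powers a
    y′0≡1 : y 0 + a * 0ℚ ≡ 1ℚ
    y′0≡1 = trans (cong₂ _+_ y0≡1 (*-zeroʳ a)) (+-identityʳ 1ℚ)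
    EHG≗G : alternate y ⊛ (H ⊛ G) ≗ G
    EHG≗G k = trans (sym (⊛-assoc (alternate y) H G k))
                    (trans (⊛-congˡ G (hSeries-inverse y y0≡1) k) (⊛-identityˡ G k))
    inverse : alternate (y ⊕ a ⋆ shift y) ⊛ (H ⊛ G) ≗ 𝟙
    inverse k = begin
      (alternate (y ⊕ a ⋆ shift y) ⊛ (H ⊛ G)) k
        ≡⟨ ⊛-congˡ (H ⊛ G) (alternate-step y a) k ⟩
      ((alternate y ⊕ (- a) ⋆ shift (alternate y)) ⊛ (H ⊛ G)) k
        ≡⟨ ⊛-⊕⋆shiftˡ (- a) (alternate y) (H ⊛ G) k ⟩
      (alternate y ⊛ (H ⊛ G)) k + (- a) * shift (alternate y ⊛ (H ⊛ G)) k
        ≡⟨ cong₂ (λ u v → u + (- a) * v) (EHG≗G k) (shift-cong EHG≗G k) ⟩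
      G k + (- a) * shift G k
        ≡⟨ powers-inverse a k ⟩
      𝟙 k ∎

  -- Newton's identities read altTail p = y′ ⊛ y⁻¹, and y⁻¹ = hSeries (alternate y).
  toPowerSums : Series → Series
  toPowerSums y zero    = 0ℚ
  toPowerSums y (suc i) = sign i * (derivative y ⊛ hSeries (alternate y)) i

  fromPowerSums-toPowerSums : ∀ y → y 0 ≡ 1ℚ → fromPowerSums (toPowerSums y) ≗ y
  fromPowerSums-toPowerSums y y0≡1 k =
    sym (recurrence-unique 1/suc (altTail (toPowerSums y)) y y0≡1 (λ k → 1/suc-solve k _ _ (step k)) k)
    where
    I = hSeries (alternate y)
    y⊛I≗𝟙 : y ⊛ I ≗ 𝟙
    y⊛I≗𝟙 k = trans (⊛-congˡ I (λ i → sym (sign-involutive i (y i))) k)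
                    (hSeries-inverse (alternate y) (trans (*-identityˡ (y 0)) y0≡1) k)
    step : ∀ k → fromℕ (suc k) * y (suc k) ≡ (altTail (toPowerSums y) ⊛ y) k
    step k = sym (begin
      (altTail (toPowerSums y) ⊛ y) k ≡⟨ ⊛-congˡ y (λ i → sign-involutive i _) k ⟩
      ((derivative y ⊛ I) ⊛ y) k      ≡⟨ ⊛-assoc (derivative y) I y k ⟩
      (derivative y ⊛ (I ⊛ y)) k      ≡⟨ ⊛-congʳ (derivative y) (λ j → trans (⊛-comm I y j) (y⊛I≗𝟙 j)) k ⟩
      (derivative y ⊛ 𝟙) k            ≡⟨ ⊛-identityʳ (derivative y) k ⟩
      derivative y k                  ∎)

module RestrictedSums where

  open ℚ-Ring
  open Series
  open Arithmetic
  open Newton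
  open CompleteHomogeneous
  open import Defs using (sign)
  open import Data.Nat as ℕ using (ℕ; zero; suc; _∸_; s≤s)
  import Data.Nat.Properties as ℕ
  open import Data.Nat.Properties using (_≤?_; +-∸-assoc; ≰⇒>)
  open import Data.Nat.Combinatorics using (_C_; nCk+nC[k+1]≡[n+1]C[k+1]; k>n⇒nCk≡0)
  open import Data.Rational using (ℚ; 0ℚ; 1ℚ; _+_; _*_; _-_; -_)
  open import Data.Rational.Properties using (*-zeroˡ; *-zeroʳ; *-identityˡ; +-identityˡ; +-identityʳ)
  open import Data.Vec using (Vec; []; _∷_)
  open import Relation.Nullary using (yes; no)
  open import Relation.Binary.PropositionalEquality
  open import Tactic.RingSolver using (solve-∀)
  open ≡-Reasoning

  -- the coefficient of t^r in (t - 1)^k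
  coefficient : ℕ → ℕ → ℚ
  coefficient r k = fromℕ (k C r) * sign (k ∸ r)

  coefficient-pred : ℕ → ℕ → ℚ
  coefficient-pred zero    k = 0ℚ
  coefficient-pred (suc r) k = coefficient r k

  coefficient-suc : ∀ r k → coefficient r (suc k) ≡ coefficient-pred r k - coefficient r k
  coefficient-suc zero    k = flip (sign k)
    where
    flip : ∀ s → (1ℚ + 0ℚ) * (- s) ≡ 0ℚ - (1ℚ + 0ℚ) * s
    flip = solve-∀ ℚ-ring
  coefficient-suc (suc r) k = begin
    fromℕ (suc k C suc r) * sign (k ∸ r)
      ≡⟨ cong (λ n → fromℕ n * sign (k ∸ r)) (nCk+nC[k+1]≡[n+1]C[k+1] k r) ⟨
    fromℕ (k C r ℕ.+ k C suc r) * sign (k ∸ r)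
      ≡⟨ cong (_* sign (k ∸ r)) (fromℕ-+ (k C r) (k C suc r)) ⟩
    (fromℕ (k C r) + fromℕ (k C suc r)) * sign (k ∸ r)
      ≡⟨ distribute (fromℕ (k C r)) (fromℕ (k C suc r)) (sign (k ∸ r)) ⟩
    coefficient r k + fromℕ (k C suc r) * sign (k ∸ r)
      ≡⟨ cong (coefficient r k +_) (sign-flip k) ⟩
    coefficient r k - coefficient (suc r) k ∎
    where
    distribute : ∀ a b s → (a + b) * s ≡ a * s + b * s
    distribute = solve-∀ ℚ-ring
    sign-flip : ∀ k → fromℕ (k C suc r) * sign (k ∸ r) ≡ - (fromℕ (k C suc r) * sign (k ∸ suc r))
    sign-flip k with suc r ≤? k
    sign-flip (suc k) | yes (s≤s r≤k) rewrite +-∸-assoc 1 r≤k = neg-right (fromℕ (suc k C suc r)) (sign (k ∸ r))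
      where
      neg-right : ∀ c s → c * (- s) ≡ - (c * s)
      neg-right = solve-∀ ℚ-ring
    sign-flip k       | no r≮k rewrite k>n⇒nCk≡0 (≰⇒> r≮k) = zero-both (sign (k ∸ r)) (sign (k ∸ suc r))
      where
      zero-both : ∀ s t → 0ℚ * s ≡ - (0ℚ * t)
      zero-both = solve-∀ ℚ-ring

  weighted : ℕ → Series → Series
  weighted r y k = coefficient r k * y k

  weighted-pred : ℕ → Series → Series
  weighted-pred r y k = coefficient-pred r k * y k

  Q : ℕ → Series → Series
  Q r y = weighted r y ⊛ hSeries y

  Q-pred : ℕ → Series → Series
  Q-pred r y = weighted-pred r y ⊛ hSeries y

  Q-cong : ∀ r {y y′} → y ≗ y′ → Q r y ≗ Q r y′
  Q-cong r y≗ = ⊛-cong (λ k → cong (coefficient r k *_) (y≗ k)) (hSeries-cong y≗)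

  weighted-step : ∀ r y a →
    weighted r (y ⊕ a ⋆ shift y) ≗ weighted r y ⊕ (- a) ⋆ shift (weighted r y) ⊕ a ⋆ shift (weighted-pred r y)
  weighted-step r y a zero    = expand (coefficient r 0) (y 0) a
    where
    expand : ∀ c b a → c * (b + a * 0ℚ) ≡ c * b + (- a) * 0ℚ + a * 0ℚ
    expand = solve-∀ ℚ-ring
  weighted-step r y a (suc k) rewrite coefficient-suc r k =
    expand (coefficient r k) (coefficient-pred r k) (y (suc k)) (y k) a
    where
    expand : ∀ c p b₁ b₀ a → (p - c) * (b₁ + a * b₀) ≡ (p - c) * b₁ + (- a) * (c * b₀) + a * (p * b₀)
    expand = solve-∀ ℚ-ring

  Q-step : ∀ r y a → y 0 ≡ 1ℚ → Q r (y ⊕ a ⋆ shift y) ≗ Q r y ⊕ a ⋆ shift (powers a ⊛ Q-pred r y)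
  Q-step r y a y0≡1 k = begin
    (weighted r (y ⊕ a ⋆ shift y) ⊛ hSeries (y ⊕ a ⋆ shift y)) k
      ≡⟨ ⊛-cong (weighted-step r y a) (hSeries-step y a y0≡1) k ⟩
    ((W ⊕ (- a) ⋆ shift W ⊕ a ⋆ shift W⁻) ⊛ (H ⊛ G)) k
      ≡⟨ ⊛-distribʳ-⊕ (W ⊕ (- a) ⋆ shift W) (a ⋆ shift W⁻) (H ⊛ G) k ⟩
    ((W ⊕ (- a) ⋆ shift W) ⊛ (H ⊛ G)) k + ((a ⋆ shift W⁻) ⊛ (H ⊛ G)) k
      ≡⟨ cong₂ _+_ (⊛-⊕⋆shiftˡ (- a) W (H ⊛ G) k) (⋆shift-⊛ a W⁻ (H ⊛ G) k) ⟩
    ((W ⊛ (H ⊛ G)) k + (- a) * shift (W ⊛ (H ⊛ G)) k) + a * shift (W⁻ ⊛ (H ⊛ G)) k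
      ≡⟨ cong₂ (λ u v → u + a * v) first (shift-cong second k) ⟩
    Q r y k + a * shift (G ⊛ Q-pred r y) k ∎
    where
    W  = weighted r y
    W⁻ = weighted-pred r y
    H  = hSeries y
    G  = powers a
    regroup : ∀ F → F ⊛ (H ⊛ G) ≗ (F ⊛ H) ⊛ G
    regroup F j = sym (⊛-assoc F H G j)
    first : (W ⊛ (H ⊛ G)) k + (- a) * shift (W ⊛ (H ⊛ G)) k ≡ Q r y k
    first = begin
      (W ⊛ (H ⊛ G)) k + (- a) * shift (W ⊛ (H ⊛ G)) k
        ≡⟨ cong₂ (λ u v → u + (- a) * v) (regroup W k) (shift-cong (regroup W) k) ⟩
      (Q r y ⊛ G) k + (- a) * shift (Q r y ⊛ G) k  ≡⟨ ⊛-⊕⋆shiftʳ (- a) (Q r y) G k ⟨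
      (Q r y ⊛ (G ⊕ (- a) ⋆ shift G)) k            ≡⟨ ⊛-congʳ (Q r y) (powers-inverse a) k ⟩
      (Q r y ⊛ 𝟙) k                                ≡⟨ ⊛-identityʳ (Q r y) k ⟩
      Q r y k                                      ∎
    second : W⁻ ⊛ (H ⊛ G) ≗ G ⊛ Q-pred r y
    second j = trans (regroup W⁻ j) (⊛-comm (Q-pred r y) G j)

  -- A monomial either avoids the first variable or contains it to a positive power.
  pSeries : ∀ {N} → ℕ → Vec ℚ N → Series
  pSeries zero    []       = 𝟙
  pSeries (suc r) []       = 𝟘
  pSeries zero    (a ∷ xs) = pSeries zero xs
  pSeries (suc r) (a ∷ xs) = pSeries (suc r) xs ⊕ a ⋆ shift (powers a ⊛ pSeries r xs)

  Q-pred-zero : ∀ y → Q-pred zero y ≗ 𝟘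
  Q-pred-zero y k = trans (⊛-congˡ (hSeries y) (λ j → *-zeroˡ (y j)) k) (⊛-zeroˡ (hSeries y) k)

  Q-eSeries : ∀ {N} r (x : Vec ℚ N) → Q r (eSeries x) ≗ pSeries r x
  Q-eSeries zero    []       k = trans (⊛-cong weighted-𝟙 hSeries-𝟙 k) (⊛-identityˡ 𝟙 k)
    where
    weighted-𝟙 : weighted 0 𝟙 ≗ 𝟙
    weighted-𝟙 zero    = refl
    weighted-𝟙 (suc k) = *-zeroʳ (coefficient 0 (suc k))
  Q-eSeries (suc r) []       k = trans (⊛-congˡ (hSeries 𝟙) weighted-𝟙 k) (⊛-zeroˡ (hSeries 𝟙) k)
    where
    weighted-𝟙 : weighted (suc r) 𝟙 ≗ 𝟘
    weighted-𝟙 zero    = *-zeroˡ 1ℚ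
    weighted-𝟙 (suc k) = *-zeroʳ (coefficient (suc r) (suc k))
  Q-eSeries zero    (a ∷ xs) k = begin
    Q 0 (eSeries (a ∷ xs)) k
      ≡⟨ Q-step 0 (eSeries xs) a (eSeries-zero xs) k ⟩
    Q 0 (eSeries xs) k + a * shift (powers a ⊛ Q-pred 0 (eSeries xs)) k
      ≡⟨ cong (λ z → Q 0 (eSeries xs) k + a * z) (shift-cong vanishes k) ⟩
    Q 0 (eSeries xs) k + a * shift 𝟘 k
      ≡⟨ cong (Q 0 (eSeries xs) k +_) (trans (cong (a *_) (shift-𝟘 k)) (*-zeroʳ a)) ⟩
    Q 0 (eSeries xs) k + 0ℚ
      ≡⟨ +-identityʳ _ ⟩
    Q 0 (eSeries xs) k
      ≡⟨ Q-eSeries zero xs k ⟩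
    pSeries zero xs k ∎
    where
    vanishes : powers a ⊛ Q-pred 0 (eSeries xs) ≗ 𝟘
    vanishes j = trans (⊛-congʳ (powers a) (Q-pred-zero (eSeries xs)) j) (⊛-zeroʳ (powers a) j)
    shift-𝟘 : shift 𝟘 ≗ 𝟘
    shift-𝟘 zero    = refl
    shift-𝟘 (suc j) = refl
  Q-eSeries (suc r) (a ∷ xs) k = begin
    Q (suc r) (eSeries (a ∷ xs)) k
      ≡⟨ Q-step (suc r) (eSeries xs) a (eSeries-zero xs) k ⟩
    Q (suc r) (eSeries xs) k + a * shift (powers a ⊛ Q r (eSeries xs)) k
      ≡⟨ cong₂ (λ u v → u + a * v) (Q-eSeries (suc r) xs k) (shift-cong (⊛-congʳ (powers a) (Q-eSeries r xs)) k) ⟩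
    pSeries (suc r) (a ∷ xs) k ∎

  pSeries-below : ∀ {N} r (x : Vec ℚ N) j → j ℕ.< r → pSeries r x j ≡ 0ℚ
  pSeries-below (suc r) []       j       _         = refl
  pSeries-below (suc r) (a ∷ xs) zero    j<r       =
    trans (cong₂ _+_ (pSeries-below (suc r) xs 0 j<r) (*-zeroʳ a)) (+-identityʳ 0ℚ)
  pSeries-below (suc r) (a ∷ xs) (suc j) (s≤s j<r) = begin
    pSeries (suc r) xs (suc j) + a * (powers a ⊛ pSeries r xs) j
      ≡⟨ cong₂ (λ u v → u + a * v) (pSeries-below (suc r) xs (suc j) (s≤s j<r))
           (⊛-vanishingʳ j (powers a) (pSeries r xs) (λ i i≤j → pSeries-below r xs i (ℕ.≤-<-trans i≤j j<r))) ⟩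
    0ℚ + a * 0ℚ ≡⟨ trans (+-identityˡ _) (*-zeroʳ a) ⟩
    0ℚ ∎

  pSeries-diagonal : ∀ {N} k (x : Vec ℚ N) → pSeries k x k ≡ eSeries x k
  pSeries-diagonal zero    []       = refl
  pSeries-diagonal (suc k) []       = refl
  pSeries-diagonal zero    (a ∷ xs) =
    trans (pSeries-diagonal zero xs) (sym (trans (cong (eSeries xs 0 +_) (*-zeroʳ a)) (+-identityʳ _)))
  pSeries-diagonal (suc k) (a ∷ xs) = cong₂ (λ u v → u + a * v) (pSeries-diagonal (suc k) xs)
    (trans (⊛-leadingʳ k (powers a) (pSeries k xs) (λ i i<k → pSeries-below k xs i i<k))
           (trans (*-identityˡ _) (pSeries-diagonal k xs)))

module FiniteSums where

  open ℚ-Ring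
  open import Defs using (sumℚ)
  open import Data.Nat as ℕ using (ℕ; zero; suc; s≤s)
  import Data.Nat.Properties as ℕ
  open import Data.Rational using (ℚ; 0ℚ; 1ℚ; _+_; _*_; _-_)
  open import Data.Rational.Properties
    using (+-identityˡ; +-identityʳ; +-assoc; *-identityˡ; *-zeroˡ; *-zeroʳ; *-distribˡ-+; *-distribʳ-+)
  open import Data.List using (List; []; _∷_; map; filter; concatMap; _++_; applyUpTo)
  open import Data.Empty using (⊥-elim)
  open import Relation.Nullary using (Dec; yes; no; ¬_)
  open import Relation.Nullary.Decidable using (_×-dec_)
  open import Relation.Unary using (Pred; Decidable)
  open import Relation.Binary.PropositionalEquality
  open import Tactic.RingSolver using (solve-∀)

  𝕀 : ∀ {p} {P : Set p} → Dec P → ℚ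
  𝕀 (yes _) = 1ℚ
  𝕀 (no _)  = 0ℚ

  𝕀-cong : ∀ {p q} {P : Set p} {Q : Set q} → (P → Q) → (Q → P) → (P? : Dec P) (Q? : Dec Q) → 𝕀 P? ≡ 𝕀 Q?
  𝕀-cong to from (yes p) (yes q) = refl
  𝕀-cong to from (yes p) (no ¬q) = ⊥-elim (¬q (to p))
  𝕀-cong to from (no ¬p) (yes q) = ⊥-elim (¬p (from q))
  𝕀-cong to from (no ¬p) (no ¬q) = refl

  𝕀-yes : ∀ {p} {P : Set p} → P → (P? : Dec P) → 𝕀 P? ≡ 1ℚ
  𝕀-yes p (yes _) = refl
  𝕀-yes p (no ¬p) = ⊥-elim (¬p p)

  𝕀-no : ∀ {p} {P : Set p} → ¬ P → (P? : Dec P) → 𝕀 P? ≡ 0ℚ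
  𝕀-no ¬p (yes p) = ⊥-elim (¬p p)
  𝕀-no ¬p (no _)  = refl

  𝕀-× : ∀ {p q} {P : Set p} {Q : Set q} (P? : Dec P) (Q? : Dec Q) → 𝕀 (P? ×-dec Q?) ≡ 𝕀 P? * 𝕀 Q?
  𝕀-× (yes p) (yes q) = refl
  𝕀-× (yes p) (no ¬q) = refl
  𝕀-× (no ¬p) Q?      = sym (*-zeroˡ (𝕀 Q?))

  module _ {a} {A : Set a} where

    sumℚ-filter : ∀ {p} {P : Pred A p} (P? : Decidable P) (f : A → ℚ) xs →
                 sumℚ (map f (filter P? xs)) ≡ sumℚ (map (λ z → 𝕀 (P? z) * f z) xs)
    sumℚ-filter P? f []       = refl
    sumℚ-filter P? f (x ∷ xs) with P? x
    ... | yes _ = trans (cong (f x +_) (sumℚ-filter P? f xs)) (cong (_+ _) (sym (*-identityˡ (f x))))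
    ... | no _  = trans (sumℚ-filter P? f xs) (sym (trans (cong (_+ _) (*-zeroˡ (f x))) (+-identityˡ _)))

    sumℚ-++ : ∀ (f : A → ℚ) xs ys → sumℚ (map f (xs ++ ys)) ≡ sumℚ (map f xs) + sumℚ (map f ys)
    sumℚ-++ f []       ys = sym (+-identityˡ _)
    sumℚ-++ f (x ∷ xs) ys = trans (cong (f x +_) (sumℚ-++ f xs ys)) (sym (+-assoc (f x) _ _))

    sumℚ-scale : ∀ c (f : A → ℚ) xs → sumℚ (map (λ z → c * f z) xs) ≡ c * sumℚ (map f xs)
    sumℚ-scale c f []       = sym (*-zeroʳ c)
    sumℚ-scale c f (x ∷ xs) = trans (cong (c * f x +_) (sumℚ-scale c f xs)) (sym (*-distribˡ-+ c (f x) _))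

    sumℚ-scaleʳ : ∀ c (f : A → ℚ) xs → sumℚ (map (λ z → f z * c) xs) ≡ sumℚ (map f xs) * c
    sumℚ-scaleʳ c f []       = sym (*-zeroˡ c)
    sumℚ-scaleʳ c f (x ∷ xs) = trans (cong (f x * c +_) (sumℚ-scaleʳ c f xs)) (sym (*-distribʳ-+ c (f x) _))

    sumℚ-+ : ∀ (f g : A → ℚ) xs → sumℚ (map (λ z → f z + g z) xs) ≡ sumℚ (map f xs) + sumℚ (map g xs)
    sumℚ-+ f g []       = refl
    sumℚ-+ f g (x ∷ xs) = trans (cong (f x + g x +_) (sumℚ-+ f g xs)) (interchange (f x) (g x) _ _)
      where
      interchange : ∀ a b c d → a + b + (c + d) ≡ (a + c) + (b + d)
      interchange = solve-∀ ℚ-ring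

    sumℚ-zero : ∀ (f : A → ℚ) xs → (∀ z → f z ≡ 0ℚ) → sumℚ (map f xs) ≡ 0ℚ
    sumℚ-zero f []       f≡0 = refl
    sumℚ-zero f (x ∷ xs) f≡0 = trans (cong₂ _+_ (f≡0 x) (sumℚ-zero f xs f≡0)) (+-identityˡ 0ℚ)

  module _ {a b} {A : Set a} {B : Set b} where

    sumℚ-concatMap : ∀ (f : B → ℚ) (g : A → List B) xs →
                    sumℚ (map f (concatMap g xs)) ≡ sumℚ (map (λ z → sumℚ (map f (g z))) xs)
    sumℚ-concatMap f g []       = refl
    sumℚ-concatMap f g (x ∷ xs) =
      trans (sumℚ-++ f (g x) (concatMap g xs)) (cong (sumℚ (map f (g x)) +_) (sumℚ-concatMap f g xs))

    sumℚ-swap : ∀ (F : A → B → ℚ) xs ys →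
               sumℚ (map (λ x → sumℚ (map (F x) ys)) xs) ≡ sumℚ (map (λ y → sumℚ (map (λ x → F x y) xs)) ys)
    sumℚ-swap F []       ys = sym (sumℚ-zero (λ _ → 0ℚ) ys (λ _ → refl))
    sumℚ-swap F (x ∷ xs) ys = trans (cong (sumℚ (map (F x) ys) +_) (sumℚ-swap F xs ys))
      (sym (sumℚ-+ (F x) (λ y → sumℚ (map (λ x′ → F x′ y) xs)) ys))

  sumRange : ℕ → (ℕ → ℚ) → ℚ
  sumRange zero    h = 0ℚ
  sumRange (suc n) h = h 0 + sumRange n (λ i → h (suc i))

  sumℚ-applyUpTo : ∀ {a} {A : Set a} (g : A → ℚ) (f : ℕ → A) n →
                  sumℚ (map g (applyUpTo f n)) ≡ sumRange n (λ i → g (f i))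
  sumℚ-applyUpTo g f zero    = refl
  sumℚ-applyUpTo g f (suc n) = cong (g (f 0) +_) (sumℚ-applyUpTo g (λ i → f (suc i)) n)

  sumRange-cong : ∀ n {h h′} → (∀ i → h i ≡ h′ i) → sumRange n h ≡ sumRange n h′
  sumRange-cong zero    h≡ = refl
  sumRange-cong (suc n) h≡ = cong₂ _+_ (h≡ 0) (sumRange-cong n (λ i → h≡ (suc i)))

  sumRange-scale : ∀ c n h → sumRange n (λ i → c * h i) ≡ c * sumRange n h
  sumRange-scale c zero    h = sym (*-zeroʳ c)
  sumRange-scale c (suc n) h =
    trans (cong (c * h 0 +_) (sumRange-scale c n (λ i → h (suc i)))) (sym (*-distribˡ-+ c (h 0) _))

  sumRange-zero : ∀ n h → (∀ i → h i ≡ 0ℚ) → sumRange n h ≡ 0ℚ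
  sumRange-zero zero    h h≡0 = refl
  sumRange-zero (suc n) h h≡0 =
    trans (cong₂ _+_ (h≡0 0) (sumRange-zero n (λ i → h (suc i)) (λ i → h≡0 (suc i)))) (+-identityˡ 0ℚ)

  sumRange-single : ∀ n h j → j ℕ.< n → (∀ i → i ≢ j → h i ≡ 0ℚ) → sumRange n h ≡ h j
  sumRange-single (suc n) h zero    _         h≡0 =
    trans (cong (h 0 +_) (sumRange-zero n (λ i → h (suc i)) (λ i → h≡0 (suc i) (λ ())))) (+-identityʳ (h 0))
  sumRange-single (suc n) h (suc j) (s≤s j<n) h≡0 =
    trans (cong (_+ sumRange n (λ i → h (suc i))) (h≡0 0 (λ ())))
    (trans (+-identityˡ _) (sumRange-single n (λ i → h (suc i)) j j<n (λ i i≢j → h≡0 (suc i) (λ eq → i≢j (cong ℕ.pred eq)))))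

  sumℚ-pick : ∀ n g (F : ℕ → ℚ) → 1 ℕ.≤ g → g ℕ.≤ n →
             sumℚ (map (λ j → 𝕀 (j ℕ.≟ g) * F j) (applyUpTo suc n)) ≡ F g
  sumℚ-pick n (suc g) F _ g<n = begin
    sumℚ (map (λ j → 𝕀 (j ℕ.≟ suc g) * F j) (applyUpTo suc n))
      ≡⟨ sumℚ-applyUpTo (λ j → 𝕀 (j ℕ.≟ suc g) * F j) suc n ⟩
    sumRange n (λ i → 𝕀 (suc i ℕ.≟ suc g) * F (suc i))
      ≡⟨ sumRange-single n _ g g<n (λ i i≢g → trans (cong (_* F (suc i)) (𝕀-no (λ eq → i≢g (ℕ.suc-injective eq)) (suc i ℕ.≟ suc g)))
                                                      (*-zeroˡ (F (suc i)))) ⟩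
    𝕀 (suc g ℕ.≟ suc g) * F (suc g)
      ≡⟨ cong (_* F (suc g)) (𝕀-yes refl (suc g ℕ.≟ suc g)) ⟩
    1ℚ * F (suc g)
      ≡⟨ *-identityˡ (F (suc g)) ⟩
    F (suc g) ∎
    where open ≡-Reasoning

  sumRange-geometric : ∀ t n (h : ℕ → ℚ) → (∀ i → h (suc i) ≡ t * h i) → (1ℚ - t) * sumRange n h ≡ h 0 - h n
  sumRange-geometric t zero    h h-suc = cancel t (h 0)
    where
    cancel : ∀ t a → (1ℚ - t) * 0ℚ ≡ a - a
    cancel = solve-∀ ℚ-ring
  sumRange-geometric t (suc n) h h-suc = begin
    (1ℚ - t) * (h 0 + sumRange n (λ i → h (suc i)))
      ≡⟨ *-distribˡ-+ (1ℚ - t) (h 0) _ ⟩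
    (1ℚ - t) * h 0 + (1ℚ - t) * sumRange n (λ i → h (suc i))
      ≡⟨ cong ((1ℚ - t) * h 0 +_) (sumRange-geometric t n (λ i → h (suc i)) (λ i → h-suc (suc i))) ⟩
    (1ℚ - t) * h 0 + (h 1 - h (suc n))
      ≡⟨ cong (λ z → (1ℚ - t) * h 0 + (z - h (suc n))) (h-suc 0) ⟩
    (1ℚ - t) * h 0 + (t * h 0 - h (suc n))
      ≡⟨ telescope t (h 0) (h (suc n)) ⟩
    h 0 - h (suc n) ∎
    where
    open ≡-Reasoning
    telescope : ∀ t a b → (1ℚ - t) * a + (t * a - b) ≡ a - b
    telescope = solve-∀ ℚ-ring

module Sorting where

  open import Data.Nat as ℕ using (ℕ; zero; suc; _≤_; z≤n)
  import Data.Nat.Properties as ℕ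
  open import Data.Nat.ListAction using (sum)
  open import Data.Nat.ListAction.Properties using (sum-↭)
  open import Data.List using (List; []; _∷_; _++_; _∷ʳ_; length; replicate)
  open import Data.List.Properties using (∷-injectiveˡ; ∷-injectiveʳ)
  open import Data.List.Relation.Unary.All using (All; []; _∷_)
  open import Data.List.Relation.Unary.Linked using ([]; [-]; _∷_)
  open import Data.List.Relation.Binary.Pointwise using (Pointwise-≡⇒≡)
  open import Data.List.Relation.Binary.Permutation.Propositional
    using (_↭_; ↭-refl; ↭-sym; ↭-trans; ↭-prep; ↭⇒↭ₛ)
  open import Data.List.Relation.Binary.Permutation.Propositional.Properties
    using (↭-length; All-resp-↭; ++-comm; ++⁺ˡ; ++⁺ʳ; ∷↭∷ʳ)
  open import Data.List.Relation.Unary.Sorted.TotalOrder ℕ.≤-totalOrder using (Sorted)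
  open import Data.List.Relation.Unary.Sorted.TotalOrder.Properties using (↗↭↗⇒≋)
  open import Data.List.Sort.InsertionSort ℕ.≤-decTotalOrder using (sort)
  open import Data.List.Sort.InsertionSort.Properties ℕ.≤-decTotalOrder using (sort-↭; sort-↗)
  open import Data.Product using (_×_; _,_)
  open import Relation.Binary.PropositionalEquality

  sort-unique : ∀ {xs ys} → Sorted ys → xs ↭ ys → sort xs ≡ ys
  sort-unique {xs} ys↗ xs↭ys =
    Pointwise-≡⇒≡ (↗↭↗⇒≋ ℕ.≤-totalOrder (sort-↗ xs) ys↗ (↭⇒↭ₛ (↭-trans (sort-↭ xs) xs↭ys)))

  sort-↭-cong : ∀ {xs ys} → xs ↭ ys → sort xs ≡ sort ys
  sort-↭-cong {xs} {ys} xs↭ys = sort-unique (sort-↗ ys) (↭-trans xs↭ys (↭-sym (sort-↭ ys)))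

  sort-All : ∀ {P : ℕ → Set} xs → All P xs → All P (sort xs)
  sort-All xs = All-resp-↭ (↭-sym (sort-↭ xs))

  length-sort : ∀ xs → length (sort xs) ≡ length xs
  length-sort xs = ↭-length (sort-↭ xs)

  sum-sort : ∀ xs → sum (sort xs) ≡ sum xs
  sum-sort xs = sum-↭ (sort-↭ xs)

  Positive : List ℕ → Set
  Positive = All (1 ≤_)

  zeros : ℕ → List ℕ
  zeros z = replicate z 0

  zeros-++-sorted : ∀ z {s} → Sorted s → Sorted (zeros z ++ s)
  zeros-++-sorted zero    s↗            = s↗
  zeros-++-sorted (suc zero)    {[]}    _ = [-]
  zeros-++-sorted (suc zero)    {_ ∷ _} s↗ = z≤n ∷ s↗
  zeros-++-sorted (suc (suc z)) s↗      = z≤n ∷ zeros-++-sorted (suc z) s↗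

  sort-zeros-++ : ∀ z xs → sort (zeros z ++ xs) ≡ zeros z ++ sort xs
  sort-zeros-++ z xs = sort-unique (zeros-++-sorted z (sort-↗ xs)) (++⁺ˡ (zeros z) (↭-sym (sort-↭ xs)))

  sort-++-zeros : ∀ xs z → sort (xs ++ zeros z) ≡ zeros z ++ sort xs
  sort-++-zeros xs z = trans (sort-↭-cong (++-comm xs (zeros z))) (sort-zeros-++ z xs)

  zeros-++-injective : ∀ a b {u v} → Positive u → Positive v → zeros a ++ u ≡ zeros b ++ v → a ≡ b × u ≡ v
  zeros-++-injective zero    zero    _         _         eq = refl , eq
  zeros-++-injective zero    (suc b) (1≤x ∷ _) _         eq with () ← subst (1 ≤_) (∷-injectiveˡ eq) 1≤x
  zeros-++-injective (suc a) zero    _         (1≤y ∷ _) eq with () ← subst (1 ≤_) (sym (∷-injectiveˡ eq)) 1≤y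
  zeros-++-injective (suc a) (suc b) u⁺        v⁺        eq
    with refl , u≡v ← zeros-++-injective a b u⁺ v⁺ (∷-injectiveʳ eq) = refl , u≡v

  ∷ʳ-sorted⁺ : ∀ {s j} → Sorted s → All (_≤ j) s → Sorted (s ∷ʳ j)
  ∷ʳ-sorted⁺ {[]}         _               _            = [-]
  ∷ʳ-sorted⁺ {x ∷ []}     _               (x≤j ∷ [])   = x≤j ∷ [-]
  ∷ʳ-sorted⁺ {x ∷ y ∷ s}  (x≤y ∷ ys↗)     (_ ∷ y≤j∷s)  = x≤y ∷ ∷ʳ-sorted⁺ ys↗ y≤j∷s

  ∷ʳ-sorted⁻ : ∀ s {g} → Sorted (s ∷ʳ g) → Sorted s × All (_≤ g) s
  ∷ʳ-sorted⁻ []              _             = [] , []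
  ∷ʳ-sorted⁻ (x ∷ [])        (x≤g ∷ _)     = [-] , (x≤g ∷ [])
  ∷ʳ-sorted⁻ (x ∷ y ∷ s)     (x≤y ∷ ys↗)
    with ys↗′ , (y≤g ∷ s≤g) ← ∷ʳ-sorted⁻ (y ∷ s) ys↗ = (x≤y ∷ ys↗′) , (ℕ.≤-trans x≤y y≤g ∷ y≤g ∷ s≤g)

  sort-∷-max : ∀ j xs → All (_≤ j) xs → sort (j ∷ xs) ≡ sort xs ∷ʳ j
  sort-∷-max j xs xs≤j = sort-unique (∷ʳ-sorted⁺ (sort-↗ xs) (sort-All xs xs≤j))
    (↭-trans (∷↭∷ʳ j xs) (++⁺ʳ (j ∷ []) (↭-sym (sort-↭ xs))))

module ExponentVectors where

  open Sorting
  open import Data.Nat as ℕ using (ℕ; zero; suc; _≤_; _∸_; z≤n; s≤s)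
  import Data.Nat.Properties as ℕ
  open import Data.Nat.ListAction using (sum)
  open import Data.List using (List; []; _∷_; _++_; length; replicate)
  open import Data.List.Properties using (length-replicate)
  open import Data.List.Relation.Unary.All using ([]; _∷_)
  open import Data.List.Relation.Binary.Permutation.Propositional using (_↭_; ↭-refl; ↭-sym; ↭-trans; ↭-prep)
  open import Data.List.Relation.Binary.Permutation.Propositional.Properties using (shift)
  open import Data.List.Sort.InsertionSort ℕ.≤-decTotalOrder using (sort)
  open import Data.Vec using (Vec; []; _∷_; toList)
  open import Data.Product using (proj₂)
  open import Data.Empty using (⊥-elim)
  open import Function.Bundles using (_⇔_; mk⇔)
  open import Relation.Binary.PropositionalEquality
  open ≡-Reasoning

  nonzeros : ∀ {N} → Vec ℕ N → List ℕ
  nonzeros []          = []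
  nonzeros (zero  ∷ α) = nonzeros α
  nonzeros (suc a ∷ α) = suc a ∷ nonzeros α

  zeroCount : ∀ {N} → Vec ℕ N → ℕ
  zeroCount []          = 0
  zeroCount (zero  ∷ α) = suc (zeroCount α)
  zeroCount (suc a ∷ α) = zeroCount α

  nonzeroCount : ∀ {N} → Vec ℕ N → ℕ
  nonzeroCount α = length (nonzeros α)

  zeroCount+nonzeroCount : ∀ {N} (α : Vec ℕ N) → zeroCount α ℕ.+ nonzeroCount α ≡ N
  zeroCount+nonzeroCount []          = refl
  zeroCount+nonzeroCount (zero  ∷ α) = cong suc (zeroCount+nonzeroCount α)
  zeroCount+nonzeroCount (suc a ∷ α) = trans (ℕ.+-suc (zeroCount α) _) (cong suc (zeroCount+nonzeroCount α))

  zeroCount≡N∸nonzeroCount : ∀ {N} (α : Vec ℕ N) → zeroCount α ≡ N ∸ nonzeroCount α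
  zeroCount≡N∸nonzeroCount {N} α = trans (sym (ℕ.m+n∸n≡m (zeroCount α) (nonzeroCount α)))
                           (cong (_∸ nonzeroCount α) (zeroCount+nonzeroCount α))

  sum-nonzeros : ∀ {N} (α : Vec ℕ N) → sum (nonzeros α) ≡ sum (toList α)
  sum-nonzeros []          = refl
  sum-nonzeros (zero  ∷ α) = sum-nonzeros α
  sum-nonzeros (suc a ∷ α) = cong (suc a ℕ.+_) (sum-nonzeros α)

  nonzeros-positive : ∀ {N} (α : Vec ℕ N) → Positive (nonzeros α)
  nonzeros-positive []          = []
  nonzeros-positive (zero  ∷ α) = nonzeros-positive α
  nonzeros-positive (suc a ∷ α) = s≤s z≤n ∷ nonzeros-positive α

  toList↭zeros++nonzeros : ∀ {N} (α : Vec ℕ N) → toList α ↭ zeros (zeroCount α) ++ nonzeros α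
  toList↭zeros++nonzeros []          = ↭-refl
  toList↭zeros++nonzeros (zero  ∷ α) = ↭-prep 0 (toList↭zeros++nonzeros α)
  toList↭zeros++nonzeros (suc a ∷ α) =
    ↭-trans (↭-prep (suc a) (toList↭zeros++nonzeros α)) (↭-sym (shift (suc a) (zeros (zeroCount α)) (nonzeros α)))

  sort-toList : ∀ {N} (α : Vec ℕ N) → sort (toList α) ≡ zeros (zeroCount α) ++ sort (nonzeros α)
  sort-toList α = trans (sort-↭-cong (toList↭zeros++nonzeros α)) (sort-zeros-++ (zeroCount α) (nonzeros α))

  nonzeroCount-sort : ∀ {N} (α : Vec ℕ N) λp → sort (nonzeros α) ≡ sort λp → nonzeroCount α ≡ length λp
  nonzeroCount-sort α λp eq = trans (sym (length-sort (nonzeros α))) (trans (cong length eq) (length-sort λp))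

  sort-padded⇔ : ∀ {N} λp (α : Vec ℕ N) → Positive λp →
                 sort (toList α) ≡ sort (λp ++ zeros (N ∸ length λp)) ⇔ sort (nonzeros α) ≡ sort λp
  sort-padded⇔ {N} λp α λp⁺ = mk⇔ to from
    where
    to : sort (toList α) ≡ sort (λp ++ zeros (N ∸ length λp)) → sort (nonzeros α) ≡ sort λp
    to eq = proj₂ (zeros-++-injective (zeroCount α) (N ∸ length λp)
                     (sort-All (nonzeros α) (nonzeros-positive α)) (sort-All λp λp⁺)
                     (trans (sym (sort-toList α)) (trans eq (sort-++-zeros λp (N ∸ length λp)))))
    from : sort (nonzeros α) ≡ sort λp → sort (toList α) ≡ sort (λp ++ zeros (N ∸ length λp))
    from eq = begin
      sort (toList α)                         ≡⟨ sort-toList α ⟩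
      zeros (zeroCount α) ++ sort (nonzeros α) ≡⟨ cong₂ (λ z s → zeros z ++ s) zeroCount≡′ eq ⟩
      zeros (N ∸ length λp) ++ sort λp        ≡⟨ sort-++-zeros λp (N ∸ length λp) ⟨
      sort (λp ++ zeros (N ∸ length λp))      ∎
      where
      zeroCount≡′ : zeroCount α ≡ N ∸ length λp
      zeroCount≡′ = trans (zeroCount≡N∸nonzeroCount α) (cong (N ∸_) (nonzeroCount-sort α λp eq))

  private
    length≤sum : ∀ xs → Positive xs → length xs ≤ sum xs
    length≤sum []       []           = z≤n
    length≤sum (x ∷ xs) (1≤x ∷ xs⁺) = ℕ.+-mono-≤ 1≤x (length≤sum xs xs⁺)

    all-ones : ∀ xs → Positive xs → sum xs ≡ length xs → xs ≡ replicate (length xs) 1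
    all-ones []                  _          _  = refl
    all-ones (suc zero    ∷ xs) (_ ∷ xs⁺) eq = cong (1 ∷_) (all-ones xs xs⁺ (ℕ.suc-injective eq))
    all-ones (suc (suc a) ∷ xs) (_ ∷ xs⁺) eq = ⊥-elim (ℕ.<-irrefl (sym (ℕ.suc-injective eq))
      (s≤s (ℕ.≤-trans (length≤sum xs xs⁺) (ℕ.m≤n+m (sum xs) a))))

  sort-ones⇔ : ∀ {N} k (α : Vec ℕ N) → sum (toList α) ≡ k →
               sort (nonzeros α) ≡ sort (replicate k 1) ⇔ nonzeroCount α ≡ k
  sort-ones⇔ k α sum≡k = mk⇔ to from
    where
    to : sort (nonzeros α) ≡ sort (replicate k 1) → nonzeroCount α ≡ k
    to eq = trans (nonzeroCount-sort α (replicate k 1) eq) (length-replicate k)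
    from : nonzeroCount α ≡ k → sort (nonzeros α) ≡ sort (replicate k 1)
    from count≡k = cong sort (trans (all-ones (nonzeros α) (nonzeros-positive α) sum≡count)
                                    (cong (λ n → replicate n 1) count≡k))
      where
      sum≡count : sum (nonzeros α) ≡ nonzeroCount α
      sum≡count = trans (sum-nonzeros α) (trans sum≡k (sym count≡k))

module Partitions where

  open ℚ-Ring
  open Sorting
  open FiniteSums
  open import Defs using (partsBounded; sumℚ)
  open import Data.Nat as ℕ using (ℕ; zero; suc; _≤_; _∸_; _≤?_; _≟_; z≤n; s≤s)
  import Data.Nat.Properties as ℕ
  open import Data.Nat.ListAction using (sum)
  open import Data.Nat.ListAction.Properties using (sum-++)
  open import Data.Rational using (ℚ; 1ℚ; _*_)
  open import Data.List using (List; []; _∷_; _∷ʳ_; map; filter; concatMap; applyUpTo)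
  open import Data.List.Properties using (≡-dec; map-∘; map-cong; map-cong-local; ∷ʳ-injective)
  open import Data.List.Relation.Unary.All as All using (All; []; _∷_)
  import Data.List.Relation.Unary.All.Properties as All
  open import Data.List.Relation.Unary.Sorted.TotalOrder ℕ.≤-totalOrder using (Sorted)
  open import Data.List.Sort.InsertionSort ℕ.≤-decTotalOrder using (sort)
  open import Data.List.Reverse using (reverseView; []; _∶_∶ʳ_)
  open import Data.Product using (_×_; _,_; proj₁; proj₂)
  open import Data.Empty using (⊥-elim)
  open import Relation.Nullary.Decidable using (_×-dec_)
  open import Relation.Binary.PropositionalEquality
  open import Tactic.RingSolver using (solve-∀)
  open ≡-Reasoning

  BoundedPartition : ℕ → ℕ → List ℕ → Set
  BoundedPartition k n λp = All (_≤ k) λp × Positive λp × sum λp ≡ n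

  partsBounded-sound : ∀ f k n → All (BoundedPartition k n) (partsBounded f k n)
  partsBounded-sound zero    k zero    = ([] , [] , refl) ∷ []
  partsBounded-sound zero    k (suc n) = []
  partsBounded-sound (suc f) k zero    = ([] , [] , refl) ∷ []
  partsBounded-sound (suc f) k (suc n) =
    All.concat⁺ (All.map⁺ (All.map extend (All.zip (All.all-filter (_≤? k) js , All.filter⁺ (_≤? k) js-range))))
    where
    js = applyUpTo suc (suc n)
    js-range : All (λ j → 1 ≤ j × j ≤ suc n) js
    js-range = All.applyUpTo⁺₁ suc (suc n) (λ i<sn → s≤s z≤n , i<sn)
    extend : ∀ {j} → j ≤ k × (1 ≤ j × j ≤ suc n) →
             All (BoundedPartition k (suc n)) (map (j ∷_) (partsBounded f j (suc n ∸ j)))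
    extend {j} (j≤k , 1≤j , j≤sn) = All.map⁺ (All.map
      (λ (≤j , λ⁺ , sum≡) → (j≤k ∷ All.map (λ x≤j → ℕ.≤-trans x≤j j≤k) ≤j) , (1≤j ∷ λ⁺) ,
                            trans (cong (j ℕ.+_) sum≡) (ℕ.m+[n∸m]≡n j≤sn))
      (partsBounded-sound f j (suc n ∸ j)))

  private
    positive-sum-zero : ∀ γ → Positive γ → sum γ ≡ 0 → γ ≡ []
    positive-sum-zero []      _         _  = refl
    positive-sum-zero (x ∷ γ) (1≤x ∷ _) eq with () ← subst (1 ≤_) (ℕ.m+n≡0⇒m≡0 x eq) 1≤x

  𝕀-sort-∷-max : ∀ j g λp γ → All (_≤ j) λp →
    𝕀 (≡-dec _≟_ (sort (j ∷ λp)) (γ ∷ʳ g)) ≡ 𝕀 (j ≟ g) * 𝕀 (≡-dec _≟_ (sort λp) γ)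
  𝕀-sort-∷-max j g λp γ λp≤j = begin
    𝕀 (≡-dec _≟_ (sort (j ∷ λp)) (γ ∷ʳ g))
      ≡⟨ cong (λ s → 𝕀 (≡-dec _≟_ s (γ ∷ʳ g))) (sort-∷-max j λp λp≤j) ⟩
    𝕀 (≡-dec _≟_ (sort λp ∷ʳ j) (γ ∷ʳ g))
      ≡⟨ 𝕀-cong (λ eq → let (s≡ , j≡) = ∷ʳ-injective (sort λp) γ eq in j≡ , s≡) (λ { (refl , refl) → refl })
                (≡-dec _≟_ (sort λp ∷ʳ j) (γ ∷ʳ g)) ((j ≟ g) ×-dec ≡-dec _≟_ (sort λp) γ) ⟩
    𝕀 ((j ≟ g) ×-dec ≡-dec _≟_ (sort λp) γ)
      ≡⟨ 𝕀-× (j ≟ g) (≡-dec _≟_ (sort λp) γ) ⟩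
    𝕀 (j ≟ g) * 𝕀 (≡-dec _≟_ (sort λp) γ) ∎

  prepend-count : ∀ f j m g γ →
    sumℚ (map (λ λp → 𝕀 (≡-dec _≟_ (sort λp) (γ ∷ʳ g))) (map (j ∷_) (partsBounded f j m)))
      ≡ 𝕀 (j ≟ g) * sumℚ (map (λ λp → 𝕀 (≡-dec _≟_ (sort λp) γ)) (partsBounded f j m))
  prepend-count f j m g γ = begin
    sumℚ (map (λ λp → 𝕀 (≡-dec _≟_ (sort λp) (γ ∷ʳ g))) (map (j ∷_) (partsBounded f j m)))
      ≡⟨ cong sumℚ (map-∘ (partsBounded f j m)) ⟨
    sumℚ (map (λ λp → 𝕀 (≡-dec _≟_ (sort (j ∷ λp)) (γ ∷ʳ g))) (partsBounded f j m))
      ≡⟨ cong sumℚ (map-cong-local (All.map (λ {λp} (λp≤j , _) → 𝕀-sort-∷-max j g λp γ λp≤j) (partsBounded-sound f j m))) ⟩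
    sumℚ (map (λ λp → 𝕀 (j ≟ g) * 𝕀 (≡-dec _≟_ (sort λp) γ)) (partsBounded f j m))
      ≡⟨ sumℚ-scale (𝕀 (j ≟ g)) (λ λp → 𝕀 (≡-dec _≟_ (sort λp) γ)) (partsBounded f j m) ⟩
    𝕀 (j ≟ g) * sumℚ (map (λ λp → 𝕀 (≡-dec _≟_ (sort λp) γ)) (partsBounded f j m)) ∎

  private
    last-part : ∀ {k n} γ g → Sorted (γ ∷ʳ g) → BoundedPartition k (suc n) (γ ∷ʳ g) →
                Sorted γ × BoundedPartition g (suc n ∸ g) γ × 1 ≤ g × g ≤ k × g ≤ suc n
    last-part {k} {n} γ g γg↗ (γg≤k , γg⁺ , sum≡) =
      proj₁ (∷ʳ-sorted⁻ γ γg↗) ,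
      (proj₂ (∷ʳ-sorted⁻ γ γg↗) , proj₁ (All.∷ʳ⁻ γg⁺) , trans (sym (ℕ.m+n∸n≡m (sum γ) g)) (cong (_∸ g) sum≡′)) ,
      proj₂ (All.∷ʳ⁻ γg⁺) , proj₂ (All.∷ʳ⁻ γg≤k) , subst (g ≤_) sum≡′ (ℕ.m≤n+m g (sum γ))
      where
      sum≡′ : sum γ ℕ.+ g ≡ suc n
      sum≡′ = trans (cong (sum γ ℕ.+_) (sym (ℕ.+-identityʳ g))) (trans (sym (sum-++ γ (g ∷ []))) sum≡)

  -- Each multiset is listed once: the first part of a listed partition is its largest, so it must be
  -- the last entry g of the sorted γ, and the remaining parts are counted recursively.
  partsBounded-count : ∀ f k n γ → n ≤ f → Sorted γ → BoundedPartition k n γ →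
    sumℚ (map (λ λp → 𝕀 (≡-dec _≟_ (sort λp) γ)) (partsBounded f k n)) ≡ 1ℚ
  partsBounded-count zero    k zero γ _ _ (_ , γ⁺ , sum≡0) rewrite positive-sum-zero γ γ⁺ sum≡0 = refl
  partsBounded-count (suc f) k zero γ _ _ (_ , γ⁺ , sum≡0) rewrite positive-sum-zero γ γ⁺ sum≡0 = refl
  partsBounded-count (suc f) k (suc n) γ (s≤s n≤f) γ↗ γ-bounded@(_ , _ , sum≡) with reverseView γ
  ... | []          = ⊥-elim (ℕ.0≢1+n sum≡)
  ... | γ′ ∶ _ ∶ʳ g with γ′↗ , γ′-bounded , 1≤g , g≤k , g≤sn ← last-part γ′ g γ↗ γ-bounded = begin
    sumℚ (map F (concatMap (λ j → map (j ∷_) (parts j)) L))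
      ≡⟨ sumℚ-concatMap F (λ j → map (j ∷_) (parts j)) L ⟩
    sumℚ (map (λ j → sumℚ (map F (map (j ∷_) (parts j)))) L)
      ≡⟨ cong sumℚ (map-cong (λ j → prepend-count f j (suc n ∸ j) g γ′) L) ⟩
    sumℚ (map (λ j → 𝕀 (j ≟ g) * C j) L)
      ≡⟨ sumℚ-filter (_≤? k) (λ j → 𝕀 (j ≟ g) * C j) js ⟩
    sumℚ (map (λ j → 𝕀 (j ≤? k) * (𝕀 (j ≟ g) * C j)) js)
      ≡⟨ cong sumℚ (map-cong (λ j → left-comm (𝕀 (j ≤? k)) (𝕀 (j ≟ g)) (C j)) js) ⟩
    sumℚ (map (λ j → 𝕀 (j ≟ g) * (𝕀 (j ≤? k) * C j)) js)
      ≡⟨ sumℚ-pick (suc n) g (λ j → 𝕀 (j ≤? k) * C j) 1≤g g≤sn ⟩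
    𝕀 (g ≤? k) * C g
      ≡⟨ cong₂ _*_ (𝕀-yes g≤k (g ≤? k)) C-g ⟩
    1ℚ * 1ℚ
      ∎
    where
    parts : ℕ → List (List ℕ)
    parts j = partsBounded f j (suc n ∸ j)
    js = applyUpTo suc (suc n)
    L  = filter (_≤? k) js
    F : List ℕ → ℚ
    F λp = 𝕀 (≡-dec _≟_ (sort λp) (γ′ ∷ʳ g))
    C : ℕ → ℚ
    C j = sumℚ (map (λ λp → 𝕀 (≡-dec _≟_ (sort λp) γ′)) (parts j))
    left-comm : ∀ a b c → a * (b * c) ≡ b * (a * c)
    left-comm = solve-∀ ℚ-ring
    C-g : C g ≡ 1ℚ
    C-g = partsBounded-count f g (suc n ∸ g) γ′ (ℕ.≤-trans (ℕ.∸-monoʳ-≤ (suc n) 1≤g) n≤f) γ′↗ γ′-bounded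

module Compositions where

  open ℚ-Ring
  open Series
  open FiniteSums
  open ExponentVectors
  open RestrictedSums using (pSeries)
  open import Defs using (compositions; monomial; sumℚ; _^ℚ_)
  open import Data.Nat as ℕ using (ℕ; zero; suc; _∸_; _≟_; s≤s)
  import Data.Nat.Properties as ℕ
  open import Data.Nat.ListAction using (sum)
  open import Data.Rational using (ℚ; 0ℚ; _+_; _*_)
  open import Data.Rational.Properties using (*-identityˡ; *-zeroˡ; *-zeroʳ; +-identityʳ; *-assoc)
  open import Data.List using ([]; _∷_; map; upTo)
  open import Data.List.Properties using (map-∘; map-cong)
  open import Data.List.Relation.Unary.All as All using (All; []; _∷_)
  import Data.List.Relation.Unary.All.Properties as All
  open import Data.Vec using (Vec; []; _∷_; toList)
  open import Relation.Binary.PropositionalEquality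
  open import Tactic.RingSolver using (solve-∀)
  open ≡-Reasoning

  compositions-sound : ∀ N d → All (λ α → sum (toList α) ≡ d) (compositions N d)
  compositions-sound zero    zero    = refl ∷ []
  compositions-sound zero    (suc d) = []
  compositions-sound (suc N) d = All.concat⁺ (All.map⁺ (All.applyUpTo⁺₁ (λ b → b) (suc d) prepend))
    where
    prepend : ∀ {b} → b ℕ.< suc d → All (λ α → sum (toList α) ≡ d) (map (b ∷_) (compositions N (d ∸ b)))
    prepend {b} (s≤s b≤d) =
      All.map⁺ (All.map (λ sum≡ → trans (cong (b ℕ.+_) sum≡) (ℕ.m+[n∸m]≡n b≤d)) (compositions-sound N (d ∸ b)))

  monomialSum : ∀ {N} → ℕ → ℕ → Vec ℚ N → ℚ
  monomialSum {N} n r x = sumℚ (map (λ α → 𝕀 (nonzeroCount α ≟ r) * monomial x α) (compositions N n))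

  ⊛-sumRange : ∀ f g n → (f ⊛ g) n ≡ sumRange (suc n) (λ i → f i * g (n ∸ i))
  ⊛-sumRange f g zero    = sym (+-identityʳ _)
  ⊛-sumRange f g (suc n) = cong (f 0 * g (suc n) +_) (⊛-sumRange (tail f) g n)

  private
    module FirstVariable {N} (a : ℚ) (xs : Vec ℚ N) (n : ℕ) where

      term : ℕ → ℕ → ℚ
      term r b = sumℚ (map (λ α → 𝕀 (nonzeroCount (b ∷ α) ≟ r) * (a ^ℚ b * monomial xs α)) (compositions N (n ∸ b)))

      expand : ∀ r → monomialSum n r (a ∷ xs) ≡ sumRange (suc n) (term r)
      expand r = begin
        monomialSum n r (a ∷ xs)
          ≡⟨ sumℚ-concatMap f (λ b → map (b ∷_) (compositions N (n ∸ b))) (upTo (suc n)) ⟩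
        sumℚ (map (λ b → sumℚ (map f (map (b ∷_) (compositions N (n ∸ b))))) (upTo (suc n)))
          ≡⟨ sumℚ-applyUpTo (λ b → sumℚ (map f (map (b ∷_) (compositions N (n ∸ b))))) (λ b → b) (suc n) ⟩
        sumRange (suc n) (λ b → sumℚ (map f (map (b ∷_) (compositions N (n ∸ b)))))
          ≡⟨ sumRange-cong (suc n) (λ b → cong sumℚ (map-∘ {g = f} {f = b ∷_} (compositions N (n ∸ b)))) ⟨
        sumRange (suc n) (term r) ∎
        where
        f : Vec ℕ (suc N) → ℚ
        f α = 𝕀 (nonzeroCount α ≟ r) * monomial (a ∷ xs) α

      term-zero : ∀ r → term r 0 ≡ monomialSum n r xs
      term-zero r = cong sumℚ (map-cong (λ α → cong (𝕀 (nonzeroCount α ≟ r) *_) (*-identityˡ (monomial xs α)))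
                                        (compositions N n))

      term-suc-zero : ∀ b → term 0 (suc b) ≡ 0ℚ
      term-suc-zero b = sumℚ-zero _ (compositions N (n ∸ suc b)) (λ α → *-zeroˡ (a ^ℚ suc b * monomial xs α))

      term-suc-suc : ∀ r b → term (suc r) (suc b) ≡ a ^ℚ suc b * monomialSum (n ∸ suc b) r xs
      term-suc-suc r b = begin
        term (suc r) (suc b)
          ≡⟨ cong sumℚ (map-cong (λ α → trans (cong (_* (a ^ℚ suc b * monomial xs α))
                          (𝕀-cong ℕ.suc-injective (cong suc) (suc (nonzeroCount α) ≟ suc r) (nonzeroCount α ≟ r)))
                          (left-comm (𝕀 (nonzeroCount α ≟ r)) (a ^ℚ suc b) (monomial xs α)))
                        (compositions N (n ∸ suc b))) ⟩
        sumℚ (map (λ α → a ^ℚ suc b * (𝕀 (nonzeroCount α ≟ r) * monomial xs α)) (compositions N (n ∸ suc b)))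
          ≡⟨ sumℚ-scale (a ^ℚ suc b) _ (compositions N (n ∸ suc b)) ⟩
        a ^ℚ suc b * monomialSum (n ∸ suc b) r xs ∎
        where
        left-comm : ∀ i c d → i * (c * d) ≡ c * (i * d)
        left-comm = solve-∀ ℚ-ring

  open FirstVariable

  monomialSum-pSeries : ∀ {N} r (x : Vec ℚ N) n → monomialSum n r x ≡ pSeries r x n
  monomialSum-pSeries zero    []       zero    = refl
  monomialSum-pSeries (suc r) []       zero    = refl
  monomialSum-pSeries zero    []       (suc n) = refl
  monomialSum-pSeries (suc r) []       (suc n) = refl
  monomialSum-pSeries zero    (a ∷ xs) n = begin
    monomialSum n 0 (a ∷ xs)                       ≡⟨ expand a xs n 0 ⟩
    term a xs n 0 0 + sumRange n (λ b → term a xs n 0 (suc b))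
      ≡⟨ cong₂ _+_ (term-zero a xs n 0) (sumRange-zero n _ (term-suc-zero a xs n)) ⟩
    monomialSum n 0 xs + 0ℚ                        ≡⟨ +-identityʳ _ ⟩
    monomialSum n 0 xs                             ≡⟨ monomialSum-pSeries zero xs n ⟩
    pSeries zero xs n                              ∎
  monomialSum-pSeries (suc r) (a ∷ xs) zero = begin
    monomialSum 0 (suc r) (a ∷ xs)                 ≡⟨ expand a xs 0 (suc r) ⟩
    term a xs 0 (suc r) 0 + 0ℚ                     ≡⟨ cong (_+ 0ℚ) (trans (term-zero a xs 0 (suc r)) (monomialSum-pSeries (suc r) xs 0)) ⟩
    pSeries (suc r) xs 0 + 0ℚ                      ≡⟨ cong (pSeries (suc r) xs 0 +_) (*-zeroʳ a) ⟨
    pSeries (suc r) xs 0 + a * 0ℚ                  ∎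
  monomialSum-pSeries (suc r) (a ∷ xs) (suc n) = begin
    monomialSum (suc n) (suc r) (a ∷ xs)           ≡⟨ expand a xs (suc n) (suc r) ⟩
    term a xs (suc n) (suc r) 0 + sumRange (suc n) (λ b → term a xs (suc n) (suc r) (suc b))
      ≡⟨ cong₂ _+_ (trans (term-zero a xs (suc n) (suc r)) (monomialSum-pSeries (suc r) xs (suc n)))
                   (sumRange-cong (suc n) (λ b → term-suc-suc a xs (suc n) r b)) ⟩
    pSeries (suc r) xs (suc n) + sumRange (suc n) (λ b → a ^ℚ suc b * monomialSum (n ∸ b) r xs)
      ≡⟨ cong (pSeries (suc r) xs (suc n) +_) (sumRange-cong (suc n) (λ b →
           trans (*-assoc a (a ^ℚ b) _) (cong (λ z → a * (a ^ℚ b * z)) (monomialSum-pSeries r xs (n ∸ b))))) ⟩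
    pSeries (suc r) xs (suc n) + sumRange (suc n) (λ b → a * (a ^ℚ b * pSeries r xs (n ∸ b)))
      ≡⟨ cong (pSeries (suc r) xs (suc n) +_) (sumRange-scale a (suc n) (λ b → a ^ℚ b * pSeries r xs (n ∸ b))) ⟩
    pSeries (suc r) xs (suc n) + a * sumRange (suc n) (λ b → a ^ℚ b * pSeries r xs (n ∸ b))
      ≡⟨ cong (λ z → pSeries (suc r) xs (suc n) + a * z) (⊛-sumRange (powers a) (pSeries r xs) n) ⟨
    pSeries (suc r) xs (suc n) + a * (powers a ⊛ pSeries r xs) n ∎

module MonomialExpansion where

  open Newton
  open RestrictedSums using (pSeries; pSeries-diagonal)
  open FiniteSums
  open Sorting
  open ExponentVectors
  open Partitions
  open Compositions
  open import Defs using (m; e; p; partitions; compositions; monomial; sumℚ)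
  open import Data.Nat as ℕ using (ℕ; zero; suc; _≤_; _∸_; _≟_; s≤s; z≤n)
  import Data.Nat.Properties as ℕ
  open import Data.Nat.ListAction using (sum)
  open import Data.Rational using (ℚ; 1ℚ; _*_)
  open import Data.Rational.Properties using (*-identityʳ; *-zeroʳ; *-assoc)
  open import Data.List using (List; []; _∷_; _++_; map; length; replicate)
  open import Data.List.Properties using (≡-dec; map-cong; map-cong-local)
  open import Data.List.Relation.Unary.All as All using (All; []; _∷_)
  open import Data.List.Sort.InsertionSort ℕ.≤-decTotalOrder using (sort)
  open import Data.List.Sort.InsertionSort.Properties ℕ.≤-decTotalOrder using (sort-↗)
  open import Data.Vec using (Vec; toList)
  open import Data.Product using (_,_)
  open import Function.Bundles using (Equivalence)
  open import Relation.Nullary using (Dec; yes; no)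
  open import Relation.Binary.PropositionalEquality
  open ≡-Reasoning

  m-nonzeros : ∀ λp {N} (x : Vec ℚ N) → Positive λp →
    m λp x ≡ sumℚ (map (λ α → 𝕀 (≡-dec _≟_ (sort λp) (sort (nonzeros α))) * monomial x α) (compositions N (sum λp)))
  m-nonzeros λp {N} x λp⁺ = trans
    (sumℚ-filter padded? (monomial x) (compositions N (sum λp)))
    (cong sumℚ (map-cong (λ α → cong (_* monomial x α) (𝕀-cong (to α) (from α) (padded? α) (nonzeros? α)))
                         (compositions N (sum λp))))
    where
    padded? : ∀ α → Dec (sort (toList α) ≡ sort (λp ++ zeros (N ∸ length λp)))
    padded? α = ≡-dec _≟_ _ _
    nonzeros? : ∀ α → Dec (sort λp ≡ sort (nonzeros α))
    nonzeros? α = ≡-dec _≟_ _ _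
    to : ∀ α → sort (toList α) ≡ sort (λp ++ zeros (N ∸ length λp)) → sort λp ≡ sort (nonzeros α)
    to α eq = sym (Equivalence.to (sort-padded⇔ λp α λp⁺) eq)
    from : ∀ α → sort λp ≡ sort (nonzeros α) → sort (toList α) ≡ sort (λp ++ zeros (N ∸ length λp))
    from α eq = Equivalence.from (sort-padded⇔ λp α λp⁺) (sym eq)

  private
    sum-replicate-1 : ∀ k → sum (replicate k 1) ≡ k
    sum-replicate-1 zero    = refl
    sum-replicate-1 (suc k) = cong suc (sum-replicate-1 k)

    replicate-1-positive : ∀ k → Positive (replicate k 1)
    replicate-1-positive zero    = []
    replicate-1-positive (suc k) = s≤s z≤n ∷ replicate-1-positive k

    All≤sum : ∀ xs → All (_≤ sum xs) xs
    All≤sum []       = []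
    All≤sum (x ∷ xs) = ℕ.m≤m+n x (sum xs) ∷ All.map (λ y≤ → ℕ.≤-trans y≤ (ℕ.m≤n+m (sum xs) x)) (All≤sum xs)

  e-monomialSum : ∀ {N} k (x : Vec ℚ N) → e k x ≡ monomialSum k k x
  e-monomialSum {N} k x = begin
    e k x
      ≡⟨ m-nonzeros (replicate k 1) x (replicate-1-positive k) ⟩
    sumℚ (map (λ α → 𝕀 (ones? α) * monomial x α) (compositions N (sum (replicate k 1))))
      ≡⟨ cong (λ d → sumℚ (map (λ α → 𝕀 (ones? α) * monomial x α) (compositions N d))) (sum-replicate-1 k) ⟩
    sumℚ (map (λ α → 𝕀 (ones? α) * monomial x α) (compositions N k))
      ≡⟨ cong sumℚ (map-cong-local (All.map (λ {α} sum≡k → cong (_* monomial x α) (count α sum≡k)) (compositions-sound N k))) ⟩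
    monomialSum k k x ∎
    where
    ones? : ∀ α → Dec (sort (replicate k 1) ≡ sort (nonzeros α))
    ones? α = ≡-dec _≟_ _ _
    count : ∀ α → sum (toList α) ≡ k → 𝕀 (ones? α) ≡ 𝕀 (nonzeroCount α ≟ k)
    count α sum≡k = 𝕀-cong (λ eq → Equivalence.to (sort-ones⇔ k α sum≡k) (sym eq))
                           (λ eq → sym (Equivalence.from (sort-ones⇔ k α sum≡k) eq)) (ones? α) (nonzeroCount α ≟ k)

  partitions-matching : ∀ {N} n r (α : Vec ℕ N) → sum (toList α) ≡ n →
    sumℚ (map (λ λp → 𝕀 (length λp ≟ r) * 𝕀 (≡-dec _≟_ (sort λp) (sort (nonzeros α)))) (partitions n))
      ≡ 𝕀 (nonzeroCount α ≟ r)
  partitions-matching n r α sum≡n = begin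
    sumℚ (map (λ λp → 𝕀 (length λp ≟ r) * 𝕀 (same? λp)) (partitions n))
      ≡⟨ cong sumℚ (map-cong length≡count (partitions n)) ⟩
    sumℚ (map (λ λp → 𝕀 (nonzeroCount α ≟ r) * 𝕀 (same? λp)) (partitions n))
      ≡⟨ sumℚ-scale (𝕀 (nonzeroCount α ≟ r)) (λ λp → 𝕀 (same? λp)) (partitions n) ⟩
    𝕀 (nonzeroCount α ≟ r) * sumℚ (map (λ λp → 𝕀 (same? λp)) (partitions n))
      ≡⟨ cong (𝕀 (nonzeroCount α ≟ r) *_) (partsBounded-count n n n γ ℕ.≤-refl (sort-↗ (nonzeros α)) γ-bounded) ⟩
    𝕀 (nonzeroCount α ≟ r) * 1ℚ
      ≡⟨ *-identityʳ _ ⟩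
    𝕀 (nonzeroCount α ≟ r) ∎
    where
    γ = sort (nonzeros α)
    same? : ∀ λp → Dec (sort λp ≡ γ)
    same? λp = ≡-dec _≟_ _ _
    sum≡n′ : sum (nonzeros α) ≡ n
    sum≡n′ = trans (sum-nonzeros α) sum≡n
    γ-bounded : BoundedPartition n n γ
    γ-bounded = sort-All (nonzeros α) (subst (λ s → All (_≤ s) (nonzeros α)) sum≡n′ (All≤sum (nonzeros α)))
              , sort-All (nonzeros α) (nonzeros-positive α)
              , trans (sum-sort (nonzeros α)) sum≡n′
    length≡count : ∀ λp → 𝕀 (length λp ≟ r) * 𝕀 (same? λp) ≡ 𝕀 (nonzeroCount α ≟ r) * 𝕀 (same? λp)
    length≡count λp with same? λp
    ... | yes eq = cong (λ l → 𝕀 (l ≟ r) * 1ℚ) (sym (nonzeroCount-sort α λp (sym eq)))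
    ... | no _   = trans (*-zeroʳ (𝕀 (length λp ≟ r))) (sym (*-zeroʳ (𝕀 (nonzeroCount α ≟ r))))

  p-monomialSum : ∀ {N} n r (x : Vec ℚ N) → p n r x ≡ monomialSum n r x
  p-monomialSum {N} n r x = begin
    p n r x
      ≡⟨ sumℚ-filter (λ λp → length λp ≟ r) (λ λp → m λp x) (partitions n) ⟩
    sumℚ (map (λ λp → 𝕀 (length λp ≟ r) * m λp x) (partitions n))
      ≡⟨ cong sumℚ (map-cong-local (All.map (λ {λp} (_ , λp⁺ , sum≡n) → expand λp λp⁺ sum≡n) (partsBounded-sound n n n))) ⟩
    sumℚ (map (λ λp → sumℚ (map (G λp) (compositions N n))) (partitions n))
      ≡⟨ sumℚ-swap G (partitions n) (compositions N n) ⟩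
    sumℚ (map (λ α → sumℚ (map (λ λp → G λp α) (partitions n))) (compositions N n))
      ≡⟨ cong sumℚ (map-cong-local (All.map (λ {α} sum≡n → collect α sum≡n) (compositions-sound N n))) ⟩
    monomialSum n r x ∎
    where
    G : List ℕ → Vec ℕ N → ℚ
    G λp α = 𝕀 (length λp ≟ r) * 𝕀 (≡-dec _≟_ (sort λp) (sort (nonzeros α))) * monomial x α
    expand : ∀ λp → Positive λp → sum λp ≡ n → 𝕀 (length λp ≟ r) * m λp x ≡ sumℚ (map (G λp) (compositions N n))
    expand λp λp⁺ refl = begin
      𝕀 (length λp ≟ r) * m λp x
        ≡⟨ cong (𝕀 (length λp ≟ r) *_) (m-nonzeros λp x λp⁺) ⟩
      𝕀 (length λp ≟ r) * sumℚ (map (λ α → 𝕀 (≡-dec _≟_ (sort λp) (sort (nonzeros α))) * monomial x α) (compositions N (sum λp)))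
        ≡⟨ sumℚ-scale (𝕀 (length λp ≟ r)) _ (compositions N (sum λp)) ⟨
      sumℚ (map (λ α → 𝕀 (length λp ≟ r) * (𝕀 (≡-dec _≟_ (sort λp) (sort (nonzeros α))) * monomial x α)) (compositions N (sum λp)))
        ≡⟨ cong sumℚ (map-cong (λ α → sym (*-assoc (𝕀 (length λp ≟ r)) _ (monomial x α))) (compositions N (sum λp))) ⟩
      sumℚ (map (G λp) (compositions N (sum λp))) ∎
    collect : ∀ α → sum (toList α) ≡ n →
              sumℚ (map (λ λp → G λp α) (partitions n)) ≡ 𝕀 (nonzeroCount α ≟ r) * monomial x α
    collect α sum≡n = trans (sumℚ-scaleʳ (monomial x α) _ (partitions n))
                            (cong (_* monomial x α) (partitions-matching n r α sum≡n))

  e-eSeries : ∀ {N} k (x : Vec ℚ N) → e k x ≡ eSeries x k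
  e-eSeries k x = trans (e-monomialSum k x) (trans (monomialSum-pSeries k x k) (pSeries-diagonal k x))

  p-pSeries : ∀ {N} n r (x : Vec ℚ N) → p n r x ≡ pSeries r x n
  p-pSeries n r x = trans (p-monomialSum n r x) (monomialSum-pSeries r x n)

module PowerSumDensity where

  open ℚ-Ring
  open Series
  open Arithmetic
  open PolynomialFunctions
  open Newton using (powerSums; powerSums-++; powerSums-replicate)
  open import Defs using (_^ℚ_)
  open import Data.Nat as ℕ using (ℕ; zero; suc; _≤_; _∸_; z≤n)
  import Data.Nat.Properties as ℕ
  open import Data.Rational using (ℚ; 0ℚ; 1ℚ; _+_; _*_; _-_; -_)
  open import Data.Rational.Properties using (+-identityˡ; +-identityʳ; +-assoc; *-identityˡ; *-assoc)
  open import Data.Vec using (Vec; []; _++_; replicate)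
  open import Data.Empty using (⊥-elim)
  open import Relation.Nullary using (yes; no)
  open import Relation.Binary.PropositionalEquality
  open import Tactic.RingSolver using (solve-∀)
  open ≡-Reasoning

  poly-powers : ∀ k → IsPolynomial (λ s → powers s k)
  poly-powers = poly-^ poly-id

  poly-shiftN : ∀ j (F : ℚ → Series) → (∀ k → IsPolynomial (λ s → F s k)) → ∀ k → IsPolynomial (λ s → shiftN j (F s) k)
  poly-shiftN zero    F F-poly k       = F-poly k
  poly-shiftN (suc j) F F-poly zero    = poly-const 0ℚ
  poly-shiftN (suc j) F F-poly (suc k) = poly-shiftN j F F-poly k

  shiftN-powers : ∀ m {x y} → x * y ≡ 1ℚ → ∀ {k} → m ≤ k → shiftN m (powers y) k ≡ x ^ℚ m * y ^ℚ k
  shiftN-powers m {x} {y} xy≡1 {k} m≤k = begin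
    shiftN m (powers y) k              ≡⟨ shiftN-at m (powers y) m≤k ⟩
    y ^ℚ (k ∸ m)                       ≡⟨ *-identityˡ _ ⟨
    1ℚ * y ^ℚ (k ∸ m)                  ≡⟨ cong (_* y ^ℚ (k ∸ m)) (^ℚ-inverse x y xy≡1 m) ⟨
    x ^ℚ m * y ^ℚ m * y ^ℚ (k ∸ m)     ≡⟨ *-assoc (x ^ℚ m) _ _ ⟩
    x ^ℚ m * (y ^ℚ m * y ^ℚ (k ∸ m))   ≡⟨ cong (x ^ℚ m *_) (^ℚ-+ y m (k ∸ m)) ⟨
    x ^ℚ m * y ^ℚ (m ℕ.+ (k ∸ m))      ≡⟨ cong (λ e → x ^ℚ m * y ^ℚ e) (ℕ.m+[n∸m]≡n m≤k) ⟩
    x ^ℚ m * y ^ℚ k                    ∎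

  module _ (n : ℕ) (D : Series → ℚ)
    (D-local : ∀ f g → (∀ k → 1 ≤ k → k ≤ n → f k ≡ g k) → D f ≡ D g)
    (D-poly : ∀ (F : ℚ → Series) → (∀ k → IsPolynomial (λ s → F s k)) → IsPolynomial (λ s → D (F s)))
    (D-powerSums : ∀ {N} (x : Vec ℚ N) → D (powerSums x) ≡ 0ℚ)
    where

    private
      D-cong : ∀ {f g} → f ≗ g → D f ≡ D g
      D-cong f≗g = D-local _ _ (λ k _ _ → f≗g k)

      Good : Series → Set
      Good g = ∀ {N} (x : Vec ℚ N) → D (g ⊕ powerSums x) ≡ 0ℚ

      good-cong : ∀ {f g} → f ≗ g → Good f → Good g
      good-cong f≗g good x = trans (D-cong (λ k → cong (_+ powerSums x k) (sym (f≗g k)))) (good x)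

      good-𝟘 : Good 𝟘
      good-𝟘 x = trans (D-cong (λ k → +-identityˡ (powerSums x k))) (D-powerSums x)

      -- c ↦ D (g ⊕ c ⋆ powers s ⊕ powerSums x) is polynomial and vanishes at c = m + 1,
      -- where the argument is the power-sum series of m + 1 copies of s followed by x.
      good-⊕-powers : ∀ g → Good g → ∀ c s → Good (g ⊕ c ⋆ powers s)
      good-⊕-powers g good c s {N} x = poly-vanishing (D-poly F F-poly) vanishes c
        where
        F : ℚ → Series
        F c′ = g ⊕ c′ ⋆ powers s ⊕ powerSums x
        F-poly : ∀ k → IsPolynomial (λ c′ → F c′ k)
        F-poly k = poly-+ (poly-+ (poly-const (g k)) (poly-* poly-id (poly-const (s ^ℚ k)))) (poly-const (powerSums x k))
        vanishes : ∀ m → D (F (fromℕ (suc m))) ≡ 0ℚ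
        vanishes m = trans (D-cong copies) (good (replicate (suc m) s ++ x))
          where
          copies : F (fromℕ (suc m)) ≗ g ⊕ powerSums (replicate (suc m) s ++ x)
          copies k = begin
            g k + fromℕ (suc m) * s ^ℚ k + powerSums x k
              ≡⟨ +-assoc (g k) _ _ ⟩
            g k + (fromℕ (suc m) * s ^ℚ k + powerSums x k)
              ≡⟨ cong (λ z → g k + (z + powerSums x k)) (powerSums-replicate (suc m) s k) ⟨
            g k + (powerSums (replicate (suc m) s) k + powerSums x k)
              ≡⟨ cong (g k +_) (powerSums-++ (replicate (suc m) s) x k) ⟨
            g k + powerSums (replicate (suc m) s ++ x) k ∎

      SupportedBelow : ℕ → Series → Set
      SupportedBelow m w = ∀ k → m ≤ k → w k ≡ 0ℚ

      GoodBelow : ℕ → Set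
      GoodBelow m = ∀ g w → Good g → SupportedBelow m w → Good (g ⊕ w)

      -- s ↦ D (g ⊕ d ⋆ shiftN m (powers s) ⊕ powerSums x) is polynomial and at s = 0 gives the claim; for
      -- s = i + 1 the shifted series differs from d s⁻ᵐ ⋆ powers s only below m.
      good-⊕-δ : ∀ m → GoodBelow m → ∀ g d → Good g → Good (g ⊕ d ⋆ δ m)
      good-⊕-δ m below g d good {N} x = trans (D-cong at-zero) (poly-vanishing (D-poly F F-poly) vanishes 0ℚ)
        where
        F : ℚ → Series
        F s = g ⊕ d ⋆ shiftN m (powers s) ⊕ powerSums x
        F-poly : ∀ k → IsPolynomial (λ s → F s k)
        F-poly k = poly-+ (poly-+ (poly-const (g k)) (poly-* (poly-const d) (poly-shiftN m powers poly-powers k)))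
                          (poly-const (powerSums x k))
        at-zero : g ⊕ d ⋆ δ m ⊕ powerSums x ≗ F 0ℚ
        at-zero k = cong (λ z → g k + d * z + powerSums x k) (sym (shiftN-cong m powers-zero k))
        vanishes : ∀ i → D (F (fromℕ (suc i))) ≡ 0ℚ
        vanishes i = good-cong regroup (below h w (good-⊕-powers g good c t) w-supported) x
          where
          t = fromℕ (suc i)
          ι = (1/suc i) ^ℚ m
          c = d * ι
          h = g ⊕ c ⋆ powers t
          w = d ⋆ shiftN m (powers t) ⊕ (- c) ⋆ powers t
          w-supported : SupportedBelow m w
          w-supported k m≤k = trans (cong (λ z → d * z + (- c) * t ^ℚ k) (shiftN-powers m (1/suc-inverseˡ i) m≤k))
                                    (cancel d ι (t ^ℚ k))
            where
            cancel : ∀ d ι τ → d * (ι * τ) + (- (d * ι)) * τ ≡ 0ℚ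
            cancel = solve-∀ ℚ-ring
          regroup : h ⊕ w ≗ g ⊕ d ⋆ shiftN m (powers t)
          regroup k = cancel (g k) c (t ^ℚ k) (d * shiftN m (powers t) k)
            where
            cancel : ∀ a c τ b → (a + c * τ) + (b + (- c) * τ) ≡ a + b
            cancel = solve-∀ ℚ-ring

      good-below : ∀ m → GoodBelow m
      good-below zero    g w good w-supported =
        good-cong (λ k → sym (trans (cong (g k +_) (w-supported k z≤n)) (+-identityʳ (g k)))) good
      good-below (suc m) g w good w-supported =
        good-cong restore (good-⊕-δ m (good-below m) (g ⊕ w′) a (good-below m g w′ good w′-supported))
        where
        a = w m
        w′ = w ⊕ (- a) ⋆ δ m
        w′-supported : SupportedBelow m w′
        w′-supported k m≤k with k ℕ.≟ m
        ... | yes refl = trans (cong (λ z → a + (- a) * z) (δ-self m)) (cancel a)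
          where
          cancel : ∀ a → a + (- a) * 1ℚ ≡ 0ℚ
          cancel = solve-∀ ℚ-ring
        ... | no k≢m   = trans (cong₂ (λ u v → u + (- a) * v) (w-supported k (ℕ.≤∧≢⇒< m≤k (λ eq → k≢m (sym eq))))
                                                              (δ-other m k k≢m))
                               (vanish a)
          where
          vanish : ∀ a → 0ℚ + (- a) * 0ℚ ≡ 0ℚ
          vanish = solve-∀ ℚ-ring
        restore : g ⊕ w′ ⊕ a ⋆ δ m ≗ g ⊕ w
        restore k = cancel (g k) (w k) a (δ m k)
          where
          cancel : ∀ x y a d → (x + (y + (- a) * d)) + a * d ≡ x + y
          cancel = solve-∀ ℚ-ring

    D-vanishes : ∀ f → D f ≡ 0ℚ
    D-vanishes f = trans (D-local f (𝟘 ⊕ truncated ⊕ powerSums []) agree)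
                     (good-below (suc n) 𝟘 truncated good-𝟘 truncated-supported [])
      where
      truncated : Series
      truncated k with k ℕ.≤? n
      ... | yes _ = f k
      ... | no _  = 0ℚ
      truncated-supported : SupportedBelow (suc n) truncated
      truncated-supported k n<k with k ℕ.≤? n
      ... | yes k≤n = ⊥-elim (ℕ.<⇒≱ n<k k≤n)
      ... | no _    = refl
      agree : ∀ k → 1 ≤ k → k ≤ n → f k ≡ 0ℚ + truncated k + 0ℚ
      agree k _ k≤n with k ℕ.≤? n
      ... | yes _   = sym (trans (+-identityʳ _) (+-identityˡ (f k)))
      ... | no k≰n  = ⊥-elim (k≰n k≤n)

module AlgebraicIndependence where

  open Series
  open Arithmetic
  open PolynomialFunctions
  open Recurrence
  open Newton
  open CompleteHomogeneous
  open RestrictedSums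
  open MonomialExpansion
  open PowerSumDensity
  open import Defs using (Poly; evalPoly; monomial; eVec; p; sign)
  open import Data.Nat using (ℕ; zero; suc; _≤_; z≤n; s≤s)
  open import Data.Rational using (ℚ; 0ℚ; 1ℚ; _*_; _-_)
  import Data.Rational.Properties as ℚ
  open import Algebra.Properties.Group ℚ.+-0-group using (x∙y⁻¹≈ε⇒x≈y)
  open import Data.Fin using (Fin; zero; suc; toℕ)
  open import Data.Fin.Properties using (toℕ<n)
  open import Data.List using ([]; _∷_)
  open import Data.Vec using (Vec; []; _∷_; tabulate)
  open import Data.Vec.Properties using (tabulate-cong)
  open import Data.Product using (_,_)
  open import Relation.Binary.PropositionalEquality
  open ≡-Reasoning

  eValues : (n : ℕ) → Series → Vec ℚ n
  eValues n y = tabulate (λ j → y (suc (toℕ j)))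

  poly-monomial : ∀ {m} (F : ℚ → Fin m → ℚ) → (∀ j → IsPolynomial (λ s → F s j)) → ∀ α →
                  IsPolynomial (λ s → monomial (tabulate (F s)) α)
  poly-monomial {zero}  F F-poly []      = poly-const 1ℚ
  poly-monomial {suc m} F F-poly (a ∷ α) =
    poly-* (poly-^ (F-poly zero) a) (poly-monomial (λ s j → F s (suc j)) (λ j → F-poly (suc j)) α)

  poly-evalPoly : ∀ {m} (F : ℚ → Fin m → ℚ) → (∀ j → IsPolynomial (λ s → F s j)) → ∀ (R : Poly m) →
                  IsPolynomial (λ s → evalPoly R (tabulate (F s)))
  poly-evalPoly F F-poly []            = poly-const 0ℚ
  poly-evalPoly F F-poly ((c , α) ∷ R) =
    poly-+ (poly-* (poly-const c) (poly-monomial F F-poly α)) (poly-evalPoly F F-poly R)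

  fromPowerSums-local : ∀ n f g → (∀ k → 1 ≤ k → k ≤ n → f k ≡ g k) → ∀ k → k ≤ n → fromPowerSums f k ≡ fromPowerSums g k
  fromPowerSums-local n f g f≡g = recurrence-local 1/suc (altTail f) (altTail g) n
    (λ i i<n → cong (sign i *_) (f≡g (suc i) (s≤s z≤n) i<n))

  Q-local : ∀ r n y y′ → (∀ k → k ≤ n → y k ≡ y′ k) → Q r y n ≡ Q r y′ n
  Q-local r n y y′ y≡ = ⊛-local n (λ i i≤n → cong (coefficient r i *_) (y≡ i i≤n))
    (recurrence-local (λ _ → 1ℚ) (altTail y) (altTail y′) n (λ i i<n → cong (sign i *_) (y≡ (suc i) i<n)))

  poly-fromPowerSums : ∀ (F : ℚ → Series) → (∀ k → IsPolynomial (λ s → F s k)) →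
                       ∀ k → IsPolynomial (λ s → fromPowerSums (F s) k)
  poly-fromPowerSums F F-poly = recurrence-poly 1/suc (λ s → altTail (F s)) (λ i → poly-* (poly-const (sign i)) (F-poly (suc i)))

  poly-Q : ∀ r n (Y : ℚ → Series) → (∀ k → IsPolynomial (λ s → Y s k)) → IsPolynomial (λ s → Q r (Y s) n)
  poly-Q r n Y Y-poly = ⊛-poly n (λ s → weighted r (Y s)) (λ s → hSeries (Y s))
    (λ i _ → poly-* (poly-const (coefficient r i)) (Y-poly i))
    (λ i _ → recurrence-poly (λ _ → 1ℚ) (λ s → altTail (Y s)) (λ j → poly-* (poly-const (sign j)) (Y-poly (suc j))) i)

  module _ (n r : ℕ) (P : Poly n) (P≡p : ∀ N (x : Vec ℚ N) → evalPoly P (eVec n x) ≡ p n r x) where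

    private
      discrepancy : Series → ℚ
      discrepancy f = evalPoly P (eValues n (fromPowerSums f)) - Q r (fromPowerSums f) n

      discrepancy-local : ∀ f g → (∀ k → 1 ≤ k → k ≤ n → f k ≡ g k) → discrepancy f ≡ discrepancy g
      discrepancy-local f g f≡g = cong₂ _-_
        (cong (evalPoly P) (tabulate-cong (λ j → fromPowerSums-local n f g f≡g (suc (toℕ j)) (toℕ<n j))))
        (Q-local r n _ _ (fromPowerSums-local n f g f≡g))

      discrepancy-poly : ∀ (F : ℚ → Series) → (∀ k → IsPolynomial (λ s → F s k)) →
                         IsPolynomial (λ s → discrepancy (F s))
      discrepancy-poly F F-poly = poly-+
        (poly-evalPoly (λ s j → fromPowerSums (F s) (suc (toℕ j))) (λ j → poly-fromPowerSums F F-poly (suc (toℕ j))) P)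
        (poly-neg (poly-Q r n (λ s → fromPowerSums (F s)) (poly-fromPowerSums F F-poly)))

      discrepancy-powerSums : ∀ {N} (x : Vec ℚ N) → discrepancy (powerSums x) ≡ 0ℚ
      discrepancy-powerSums {N} x = begin
        evalPoly P (eValues n (fromPowerSums (powerSums x))) - Q r (fromPowerSums (powerSums x)) n
          ≡⟨ cong₂ _-_ (cong (evalPoly P) eValues≡eVec) (Q-cong r (newton x) n) ⟩
        evalPoly P (eVec n x) - Q r (eSeries x) n
          ≡⟨ cong₂ _-_ (P≡p N x) (trans (Q-eSeries r x n) (sym (p-pSeries n r x))) ⟩
        p n r x - p n r x
          ≡⟨ ℚ.+-inverseʳ (p n r x) ⟩
        0ℚ ∎
        where
        eValues≡eVec : eValues n (fromPowerSums (powerSums x)) ≡ eVec n x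
        eValues≡eVec = tabulate-cong (λ j → trans (newton x (suc (toℕ j))) (sym (e-eSeries (suc (toℕ j)) x)))

    evalPoly-Q : ∀ y → y 0 ≡ 1ℚ → evalPoly P (eValues n y) ≡ Q r y n
    evalPoly-Q y y0≡1 = begin
      evalPoly P (eValues n y)
        ≡⟨ cong (evalPoly P) (tabulate-cong (λ j → fromPowerSums-toPowerSums y y0≡1 (suc (toℕ j)))) ⟨
      evalPoly P (eValues n (fromPowerSums (toPowerSums y)))
        ≡⟨ x∙y⁻¹≈ε⇒x≈y _ _ (D-vanishes n discrepancy discrepancy-local discrepancy-poly discrepancy-powerSums (toPowerSums y)) ⟩
      Q r (fromPowerSums (toPowerSums y)) n
        ≡⟨ Q-cong r (fromPowerSums-toPowerSums y y0≡1) n ⟩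
      Q r y n ∎

module Factorials where

  open ℚ-Ring
  open Arithmetic
  open import Defs using (invFact)
  open import Data.Nat as ℕ using (ℕ; zero; suc; _!; _∸_; NonZero)
  import Data.Nat.Properties as ℕ
  open import Data.Nat.Combinatorics using (_C_; nCk≡n!/k![n-k]!; k![n∸k]!∣n!; nCk+nC[k+1]≡[n+1]C[k+1]; nC1≡n)
  open import Data.Nat.DivMod using (_/_; m*[n/m]≡n)
  open import Data.Integer as ℤ using (ℤ; +_)
  import Data.Integer.Properties as ℤ
  open import Data.Rational as ℚ using (ℚ; 1ℚ; _+_; _*_; toℚᵘ)
  import Data.Rational.Properties as ℚ
  import Data.Rational.Unnormalised as ℚᵘ
  import Data.Rational.Unnormalised.Properties as ℚᵘ
  open import Relation.Binary.PropositionalEquality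
  open import Tactic.RingSolver using (solve-∀)
  import Data.Nat.Tactic.RingSolver as ℕ-Solver
  import Data.Integer.Tactic.RingSolver as ℤ-Solver
  open ≡-Reasoning

  private
    toℚᵘ-fromℕ : ∀ d → toℚᵘ (fromℕ d) ℚᵘ.≃ ℚᵘ.mkℚᵘ (+ d) 0
    toℚᵘ-fromℕ zero    = ℚᵘ.≃-refl
    toℚᵘ-fromℕ (suc d) = ℚᵘ.≃-trans (ℚ.toℚᵘ-homo-+ 1ℚ (fromℕ d))
      (ℚᵘ.≃-trans (ℚᵘ.+-congʳ (toℚᵘ 1ℚ) (toℚᵘ-fromℕ d)) (ℚᵘ.*≡* (cross (+ d))))
      where
      cross : ∀ (x : ℤ) → (+ 1 ℤ.* + 1 ℤ.+ x ℤ.* + 1) ℤ.* + 1 ≡ (+ 1 ℤ.+ x) ℤ.* + 1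
      cross = ℤ-Solver.solve-∀

    1/d*d≡1 : ∀ d .{{_ : NonZero d}} → (+ 1 ℚ./ d) * fromℕ d ≡ 1ℚ
    1/d*d≡1 (suc d) = ℚ.toℚᵘ-injective (ℚᵘ.≃-trans (ℚ.toℚᵘ-homo-* (+ 1 ℚ./ suc d) (fromℕ (suc d)))
      (ℚᵘ.≃-trans (ℚᵘ.*-cong (ℚ.toℚᵘ-fromℚᵘ (ℚᵘ.mkℚᵘ (+ 1) d)) (toℚᵘ-fromℕ (suc d))) (ℚᵘ.*≡* cross)))
      where
      cross : (+ 1 ℤ.* + suc d) ℤ.* + 1 ≡ + 1 ℤ.* + (suc d ℕ.* 1)
      cross = trans (ℤ.*-identityʳ _) (cong (λ n → + 1 ℤ.* + n) (sym (ℕ.*-identityʳ (suc d))))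

  invFact-inverse : ∀ k → invFact k * fromℕ (k !) ≡ 1ℚ
  invFact-inverse k = 1/d*d≡1 (k !) {{k ℕ.!≢0}}

  factorial-split : ∀ r j → (r ℕ.+ j) ! ≡ ((r ℕ.+ j) C r) ℕ.* (r ! ℕ.* j !)
  factorial-split r j = begin
    (r ℕ.+ j) !                             ≡⟨ m*[n/m]≡n {r ! ℕ.* ((r ℕ.+ j) ∸ r) !} {{denominator≢0}} (k![n∸k]!∣n! r≤r+j) ⟨
    denominator ℕ.* ((r ℕ.+ j) ! / denominator) {{denominator≢0}}
                                            ≡⟨ cong (denominator ℕ.*_) (nCk≡n!/k![n-k]! r≤r+j) ⟨
    denominator ℕ.* ((r ℕ.+ j) C r)         ≡⟨ cong (λ i → (r ! ℕ.* i !) ℕ.* ((r ℕ.+ j) C r)) (ℕ.m+n∸m≡n r j) ⟩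
    (r ! ℕ.* j !) ℕ.* ((r ℕ.+ j) C r)       ≡⟨ ℕ.*-comm (r ! ℕ.* j !) _ ⟩
    ((r ℕ.+ j) C r) ℕ.* (r ! ℕ.* j !)       ∎
    where
    r≤r+j = ℕ.m≤m+n r j
    denominator = r ! ℕ.* ((r ℕ.+ j) ∸ r) !
    denominator≢0 : NonZero denominator
    denominator≢0 = ℕ.m*n≢0 (r !) (((r ℕ.+ j) ∸ r) !) {{r ℕ.!≢0}} {{((r ℕ.+ j) ∸ r) ℕ.!≢0}}

  invFact-split : ∀ r j → fromℕ ((r ℕ.+ j) C r) * invFact (r ℕ.+ j) ≡ invFact r * invFact j
  invFact-split r j = begin
    c * i
      ≡⟨ pad (c * i) (invFact r * fromℕ (r !)) (invFact j * fromℕ (j !)) (invFact-inverse r) (invFact-inverse j) ⟩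
    c * i * ((invFact r * fromℕ (r !)) * (invFact j * fromℕ (j !)))
      ≡⟨ regroup c i (invFact r) (invFact j) (fromℕ (r !)) (fromℕ (j !)) ⟩
    (i * (c * (fromℕ (r !) * fromℕ (j !)))) * (invFact r * invFact j)
      ≡⟨ cong (λ z → (i * z) * (invFact r * invFact j)) (sym fromℕ-split) ⟩
    (i * fromℕ ((r ℕ.+ j) !)) * (invFact r * invFact j)
      ≡⟨ cong (_* (invFact r * invFact j)) (invFact-inverse (r ℕ.+ j)) ⟩
    1ℚ * (invFact r * invFact j)
      ≡⟨ ℚ.*-identityˡ _ ⟩
    invFact r * invFact j ∎
    where
    c = fromℕ ((r ℕ.+ j) C r)
    i = invFact (r ℕ.+ j)
    fromℕ-split : fromℕ ((r ℕ.+ j) !) ≡ c * (fromℕ (r !) * fromℕ (j !))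
    fromℕ-split = trans (cong fromℕ (factorial-split r j))
                        (trans (fromℕ-* ((r ℕ.+ j) C r) _) (cong (c *_) (fromℕ-* (r !) (j !))))
    pad : ∀ x a b → a ≡ 1ℚ → b ≡ 1ℚ → x ≡ x * (a * b)
    pad x a b refl refl = sym (ℚ.*-identityʳ x)
    regroup : ∀ c i a b f g → c * i * ((a * f) * (b * g)) ≡ (i * (c * (f * g))) * (a * b)
    regroup = solve-∀ ℚ-ring

  C2-split : ∀ r j → (r ℕ.+ j) C 2 ≡ r C 2 ℕ.+ j C 2 ℕ.+ r ℕ.* j
  C2-split r zero    rewrite ℕ.+-identityʳ r | ℕ.+-identityʳ (r C 2) | ℕ.*-zeroʳ r = sym (ℕ.+-identityʳ (r C 2))
  C2-split r (suc j) = begin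
    (r ℕ.+ suc j) C 2                           ≡⟨ cong (_C 2) (ℕ.+-suc r j) ⟩
    suc (r ℕ.+ j) C 2                           ≡⟨ suc-C2 (r ℕ.+ j) ⟩
    (r ℕ.+ j) ℕ.+ (r ℕ.+ j) C 2                 ≡⟨ cong ((r ℕ.+ j) ℕ.+_) (C2-split r j) ⟩
    (r ℕ.+ j) ℕ.+ (r C 2 ℕ.+ j C 2 ℕ.+ r ℕ.* j) ≡⟨ regroup r j (r C 2) (j C 2) ⟩
    r C 2 ℕ.+ (j ℕ.+ j C 2) ℕ.+ (r ℕ.+ r ℕ.* j) ≡⟨ cong₂ (λ u v → r C 2 ℕ.+ u ℕ.+ v) (sym (suc-C2 j)) (sym (ℕ.*-suc r j)) ⟩
    r C 2 ℕ.+ suc j C 2 ℕ.+ r ℕ.* suc j         ∎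
    where
    suc-C2 : ∀ n → suc n C 2 ≡ n ℕ.+ n C 2
    suc-C2 n = trans (sym (nCk+nC[k+1]≡[n+1]C[k+1] n 1)) (cong (ℕ._+ n C 2) (nC1≡n n))
    regroup : ∀ r j a b → (r ℕ.+ j) ℕ.+ (a ℕ.+ b ℕ.+ r ℕ.* j) ≡ a ℕ.+ (j ℕ.+ b) ℕ.+ (r ℕ.+ r ℕ.* j)
    regroup = ℕ-Solver.solve-∀

module Specialization where

  open ℚ-Ring
  open Series
  open Arithmetic
  open FiniteSums using (sumℚ-applyUpTo; sumRange-geometric; sumℚ-zero)
  open Newton using (altTail)
  open CompleteHomogeneous
  open RestrictedSums
  open Factorials
  open import Defs using (ε; εℤ; invFact; qInt; sign; det; Δ; matA; sumℚ; _^ℚ_)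
  open import Data.Nat as ℕ using (ℕ; zero; suc; _∸_; _≤?_)
  import Data.Nat.Properties as ℕ
  open import Data.Nat.Combinatorics using (_C_; k>n⇒nCk≡0)
  open import Data.Rational using (ℚ; 0ℚ; 1ℚ; _+_; _*_; _-_; -_)
  open import Data.Rational.Properties using (*-identityˡ)
  open import Data.Integer as ℤ using (+_)
  import Data.Integer.Tactic.RingSolver as ℤ-Solver
  open import Data.Fin using (Fin; zero; suc; toℕ; punchIn)
  open import Data.List using (map; tabulate; allFin)
  open import Data.List.Properties using (map-cong; map-tabulate)
  open import Data.Product using (_,_)
  open import Relation.Nullary using (yes; no)
  open import Relation.Binary.PropositionalEquality
  open import Tactic.RingSolver using (solve-∀)
  open ≡-Reasoning

  εSeries : ℚ → Series
  εSeries q k = ε k q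

  ε-split : ∀ q r j → fromℕ ((r ℕ.+ j) C r) * ε (r ℕ.+ j) q ≡ ε r q * ε j q * (q ^ℚ r) ^ℚ j
  ε-split q r j = begin
    c * (q ^ℚ ((r ℕ.+ j) C 2) * i)
      ≡⟨ cong (λ e → c * (q ^ℚ e * i)) (C2-split r j) ⟩
    c * (q ^ℚ (r C 2 ℕ.+ j C 2 ℕ.+ r ℕ.* j) * i)
      ≡⟨ cong (λ z → c * (z * i)) q-powers ⟩
    c * (q ^ℚ (r C 2) * q ^ℚ (j C 2) * (q ^ℚ r) ^ℚ j * i)
      ≡⟨ regroup c (q ^ℚ (r C 2)) (q ^ℚ (j C 2)) ((q ^ℚ r) ^ℚ j) i ⟩
    (c * i) * (q ^ℚ (r C 2) * q ^ℚ (j C 2) * (q ^ℚ r) ^ℚ j)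
      ≡⟨ cong (_* (q ^ℚ (r C 2) * q ^ℚ (j C 2) * (q ^ℚ r) ^ℚ j)) (invFact-split r j) ⟩
    (invFact r * invFact j) * (q ^ℚ (r C 2) * q ^ℚ (j C 2) * (q ^ℚ r) ^ℚ j)
      ≡⟨ regroup′ (invFact r) (invFact j) (q ^ℚ (r C 2)) (q ^ℚ (j C 2)) ((q ^ℚ r) ^ℚ j) ⟩
    ε r q * ε j q * (q ^ℚ r) ^ℚ j ∎
    where
    c = fromℕ ((r ℕ.+ j) C r)
    i = invFact (r ℕ.+ j)
    q-powers : q ^ℚ (r C 2 ℕ.+ j C 2 ℕ.+ r ℕ.* j) ≡ q ^ℚ (r C 2) * q ^ℚ (j C 2) * (q ^ℚ r) ^ℚ j
    q-powers = trans (^ℚ-+ q (r C 2 ℕ.+ j C 2) (r ℕ.* j))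
                     (cong₂ _*_ (^ℚ-+ q (r C 2) (j C 2)) (trans (cong (q ^ℚ_) (ℕ.*-comm r j)) (^ℚ-* q j r)))
    regroup : ∀ c a b t i → c * (a * b * t * i) ≡ (c * i) * (a * b * t)
    regroup = solve-∀ ℚ-ring
    regroup′ : ∀ x y a b t → (x * y) * (a * b * t) ≡ a * x * (b * y) * t
    regroup′ = solve-∀ ℚ-ring

  twisted : ℚ → ℕ → Series
  twisted q r j = sign j * ε j q * (q ^ℚ r) ^ℚ j

  weighted-ε : ∀ q r → weighted r (εSeries q) ≗ shiftN r (ε r q ⋆ twisted q r)
  weighted-ε q r k with r ≤? k
  ... | yes r≤k with j , refl ← ℕ.m≤n⇒∃[o]m+o≡n r≤k = begin
    fromℕ ((r ℕ.+ j) C r) * sign ((r ℕ.+ j) ∸ r) * ε (r ℕ.+ j) q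
      ≡⟨ cong (λ i → fromℕ ((r ℕ.+ j) C r) * sign i * ε (r ℕ.+ j) q) (ℕ.m+n∸m≡n r j) ⟩
    fromℕ ((r ℕ.+ j) C r) * sign j * ε (r ℕ.+ j) q
      ≡⟨ right-comm (fromℕ ((r ℕ.+ j) C r)) (sign j) (ε (r ℕ.+ j) q) ⟩
    sign j * (fromℕ ((r ℕ.+ j) C r) * ε (r ℕ.+ j) q)
      ≡⟨ cong (sign j *_) (ε-split q r j) ⟩
    sign j * (ε r q * ε j q * (q ^ℚ r) ^ℚ j)
      ≡⟨ left-comm (sign j) (ε r q) (ε j q) ((q ^ℚ r) ^ℚ j) ⟩
    ε r q * twisted q r j
      ≡⟨ cong (λ i → ε r q * twisted q r i) (ℕ.m+n∸m≡n r j) ⟨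
    ε r q * twisted q r ((r ℕ.+ j) ∸ r)
      ≡⟨ shiftN-at r (ε r q ⋆ twisted q r) r≤k ⟨
    shiftN r (ε r q ⋆ twisted q r) (r ℕ.+ j) ∎
    where
    right-comm : ∀ a b c → a * b * c ≡ b * (a * c)
    right-comm = solve-∀ ℚ-ring
    left-comm : ∀ s a b t → s * (a * b * t) ≡ a * (s * b * t)
    left-comm = solve-∀ ℚ-ring
  ... | no r≰k = begin
    fromℕ (k C r) * sign (k ∸ r) * ε k q ≡⟨ cong (λ c → fromℕ c * sign (k ∸ r) * ε k q) (k>n⇒nCk≡0 (ℕ.≰⇒> r≰k)) ⟩
    0ℚ * sign (k ∸ r) * ε k q            ≡⟨ vanish (sign (k ∸ r)) (ε k q) ⟩
    0ℚ                                   ≡⟨ shiftN-below r _ (ℕ.≰⇒> r≰k) ⟨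
    shiftN r (ε r q ⋆ twisted q r) k     ∎
    where
    vanish : ∀ a b → 0ℚ * a * b ≡ 0ℚ
    vanish = solve-∀ ℚ-ring

  Q-ε : ∀ q r m → Q r (εSeries q) (r ℕ.+ m) ≡ ε r q * (twisted q r ⊛ hSeries (εSeries q)) m
  Q-ε q r m = begin
    (weighted r (εSeries q) ⊛ H) (r ℕ.+ m)          ≡⟨ ⊛-congˡ H (weighted-ε q r) (r ℕ.+ m) ⟩
    (shiftN r (ε r q ⋆ twisted q r) ⊛ H) (r ℕ.+ m)  ≡⟨ ⊛-shiftNˡ r _ H (r ℕ.+ m) ⟩
    shiftN r ((ε r q ⋆ twisted q r) ⊛ H) (r ℕ.+ m)  ≡⟨ shiftN-at r _ (ℕ.m≤m+n r m) ⟩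
    ((ε r q ⋆ twisted q r) ⊛ H) ((r ℕ.+ m) ∸ r)     ≡⟨ cong ((ε r q ⋆ twisted q r) ⊛ H) (ℕ.m+n∸m≡n r m) ⟩
    ((ε r q ⋆ twisted q r) ⊛ H) m                   ≡⟨ ⊛-⋆ˡ (ε r q) (twisted q r) H m ⟩
    ε r q * (twisted q r ⊛ H) m                     ∎
    where
    H = hSeries (εSeries q)

  qInt-geometric : ∀ i t → (1ℚ - t) * qInt i t ≡ 1ℚ - t ^ℚ i
  qInt-geometric i t =
    trans (cong ((1ℚ - t) *_) (sumℚ-applyUpTo (t ^ℚ_) (λ x → x) i)) (sumRange-geometric t i (t ^ℚ_) (λ _ → refl))

  twisted-step : ∀ q r m → let t = q ^ℚ r in
    (twisted q r ⊛ hSeries (εSeries q)) (suc m) ≡ (1ℚ - t) * (alternate (λ i → qInt (suc i) t * ε (suc i) q) ⊛ hSeries (εSeries q)) m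
  twisted-step q r m = begin
    1ℚ * H (suc m) + (tail B ⊛ H) m
      ≡⟨ cong (_+ (tail B ⊛ H) m) (trans (*-identityˡ (H (suc m))) (hSeries-suc (εSeries q) m)) ⟩
    (altTail (εSeries q) ⊛ H) m + (tail B ⊛ H) m
      ≡⟨ ⊛-distribʳ-⊕ (altTail (εSeries q)) (tail B) H m ⟨
    ((altTail (εSeries q) ⊕ tail B) ⊛ H) m
      ≡⟨ ⊛-congˡ H combine m ⟩
    (((1ℚ - t) ⋆ alternate c) ⊛ H) m
      ≡⟨ ⊛-⋆ˡ (1ℚ - t) (alternate c) H m ⟩
    (1ℚ - t) * (alternate c ⊛ H) m ∎
    where
    t = q ^ℚ r
    B = twisted q r
    H = hSeries (εSeries q)
    c : ℕ → ℚ
    c i = qInt (suc i) t * ε (suc i) q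
    combine : altTail (εSeries q) ⊕ tail B ≗ (1ℚ - t) ⋆ alternate c
    combine i = begin
      sign i * ε (suc i) q + (- sign i) * ε (suc i) q * (t * t ^ℚ i)
        ≡⟨ factor (sign i) (ε (suc i) q) (t * t ^ℚ i) ⟩
      sign i * ε (suc i) q * (1ℚ - t ^ℚ suc i)
        ≡⟨ cong (sign i * ε (suc i) q *_) (qInt-geometric (suc i) t) ⟨
      sign i * ε (suc i) q * ((1ℚ - t) * qInt (suc i) t)
        ≡⟨ regroup (sign i) (ε (suc i) q) (1ℚ - t) (qInt (suc i) t) ⟩
      (1ℚ - t) * (sign i * (qInt (suc i) t * ε (suc i) q)) ∎
      where
      factor : ∀ s e u → s * e + (- s) * e * u ≡ s * e * (1ℚ - u)
      factor = solve-∀ ℚ-ring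
      regroup : ∀ s e a b → s * e * (a * b) ≡ a * (s * (b * e))
      regroup = solve-∀ ℚ-ring

  εMatrix : (k : ℕ) → (ℕ → ℚ) → ℚ → Fin k → Fin k → ℚ
  εMatrix k c q i zero    = c (toℕ i)
  εMatrix k c q i (suc j) = εℤ ((+ suc (toℕ i)) ℤ.+ (+ 1) ℤ.- (+ suc (toℕ (suc j)))) q

  det-cong : ∀ k (M M′ : Fin k → Fin k → ℚ) → (∀ i j → M i j ≡ M′ i j) → det k M ≡ det k M′
  det-cong zero    M M′ M≡ = refl
  det-cong (suc k) M M′ M≡ = cong sumℚ (map-cong (λ j → cong₂ (λ u v → sign (toℕ j) * u * v) (M≡ zero j)
    (det-cong k _ _ (λ i l → M≡ (suc i) (punchIn j l)))) (allFin (suc k)))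

  det-εMatrix-expand : ∀ q k c → det (suc (suc k)) (εMatrix (suc (suc k)) c q)
    ≡ c 0 * det (suc k) (εMatrix (suc k) (tail (εSeries q)) q) - det (suc k) (εMatrix (suc k) (tail c) q)
  det-εMatrix-expand q k c = begin
    1ℚ * c 0 * det (suc k) minor₀ + ((- 1ℚ) * 1ℚ * det (suc k) minor₁ + sumℚ (map φ (tabulate (λ j → suc (suc j)))))
      ≡⟨ cong₂ (λ u v → 1ℚ * c 0 * u + ((- 1ℚ) * 1ℚ * v + sumℚ (map φ (tabulate (λ j → suc (suc j))))))
               (det-cong (suc k) minor₀ _ minor₀≡) (det-cong (suc k) minor₁ _ minor₁≡) ⟩
    1ℚ * c 0 * D₀ + ((- 1ℚ) * 1ℚ * D₁ + sumℚ (map φ (tabulate (λ j → suc (suc j)))))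
      ≡⟨ cong (λ z → 1ℚ * c 0 * D₀ + ((- 1ℚ) * 1ℚ * D₁ + z)) rest-vanishes ⟩
    1ℚ * c 0 * D₀ + ((- 1ℚ) * 1ℚ * D₁ + 0ℚ)
      ≡⟨ simplify (c 0) D₀ D₁ ⟩
    c 0 * D₀ - D₁ ∎
    where
    M = εMatrix (suc (suc k)) c q
    D₀ = det (suc k) (εMatrix (suc k) (tail (εSeries q)) q)
    D₁ = det (suc k) (εMatrix (suc k) (tail c) q)
    minor₀ minor₁ : Fin (suc k) → Fin (suc k) → ℚ
    minor₀ i l = M (suc i) (punchIn zero l)
    minor₁ i l = M (suc i) (punchIn (suc zero) l)
    φ : Fin (suc (suc k)) → ℚ
    φ j = sign (toℕ j) * M zero j * det (suc k) (λ i l → M (suc i) (punchIn j l))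
    shift-index : ∀ x y → (+ 1 ℤ.+ (+ 1 ℤ.+ x)) ℤ.+ (+ 1) ℤ.- (+ 1 ℤ.+ (+ 1 ℤ.+ (+ 1 ℤ.+ y)))
                        ≡ (+ 1 ℤ.+ x) ℤ.+ (+ 1) ℤ.- (+ 1 ℤ.+ (+ 1 ℤ.+ y))
    shift-index = ℤ-Solver.solve-∀
    minor₀≡ : ∀ i l → minor₀ i l ≡ εMatrix (suc k) (tail (εSeries q)) q i l
    minor₀≡ i zero    = cong (λ n → ε n q) (ℕ.+-comm (toℕ i) 1)
    minor₀≡ i (suc l) = cong (λ z → εℤ z q) (shift-index (+ toℕ i) (+ toℕ l))
    minor₁≡ : ∀ i l → minor₁ i l ≡ εMatrix (suc k) (tail c) q i l
    minor₁≡ i zero    = refl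
    minor₁≡ i (suc l) = cong (λ z → εℤ z q) (shift-index (+ toℕ i) (+ toℕ l))
    rest-vanishes : sumℚ (map φ (tabulate (λ j → suc (suc j)))) ≡ 0ℚ
    rest-vanishes = trans (cong sumℚ (trans (map-tabulate (λ j → suc (suc j)) φ)
                                            (sym (map-tabulate (λ j → j) (λ j → φ (suc (suc j)))))))
                          (sumℚ-zero (λ j → φ (suc (suc j))) (allFin k) (λ j → vanish (sign (suc (suc (toℕ j)))) _))
      where
      vanish : ∀ s d → s * 0ℚ * d ≡ 0ℚ
      vanish = solve-∀ ℚ-ring
    simplify : ∀ c₀ a b → 1ℚ * c₀ * a + ((- 1ℚ) * 1ℚ * b + 0ℚ) ≡ c₀ * a - b
    simplify = solve-∀ ℚ-ring

  -- The expansion along the first row (c₀, ε₀, 0, …, 0) is the recursion of alternate c ⊛ h.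
  det-εMatrix : ∀ q k c → det (suc k) (εMatrix (suc k) c q) ≡ (alternate c ⊛ hSeries (εSeries q)) k
  det-εMatrix q zero    c = simplify (c 0)
    where
    simplify : ∀ a → 1ℚ * a * 1ℚ + 0ℚ ≡ 1ℚ * a * 1ℚ
    simplify = solve-∀ ℚ-ring
  det-εMatrix q (suc k) c = begin
    det (suc (suc k)) (εMatrix (suc (suc k)) c q)
      ≡⟨ det-εMatrix-expand q k c ⟩
    c 0 * det (suc k) (εMatrix (suc k) (tail (εSeries q)) q) - det (suc k) (εMatrix (suc k) (tail c) q)
      ≡⟨ cong₂ (λ u v → c 0 * u - v) (det-εMatrix q k (tail (εSeries q))) (det-εMatrix q k (tail c)) ⟩
    c 0 * (altTail (εSeries q) ⊛ H) k - (altTail c ⊛ H) k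
      ≡⟨ cong (λ z → c 0 * z - (altTail c ⊛ H) k) (hSeries-suc (εSeries q) k) ⟨
    c 0 * H (suc k) - (altTail c ⊛ H) k
      ≡⟨ alternate-⊛-suc c H k ⟨
    (alternate c ⊛ H) (suc k) ∎
    where
    H = hSeries (εSeries q)

  Q-εSeries : ∀ q r m → Q r (εSeries q) (r ℕ.+ suc m) ≡ (1ℚ - q ^ℚ r) * invFact r * q ^ℚ (r C 2) * Δ (suc m) r q
  Q-εSeries q r m = begin
    Q r (εSeries q) (r ℕ.+ suc m)                     ≡⟨ Q-ε q r (suc m) ⟩
    ε r q * (twisted q r ⊛ H) (suc m)                 ≡⟨ cong (ε r q *_) (twisted-step q r m) ⟩
    ε r q * ((1ℚ - t) * (alternate c ⊛ H) m)          ≡⟨ cong (λ z → ε r q * ((1ℚ - t) * z)) determinant ⟨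
    ε r q * ((1ℚ - t) * Δ (suc m) r q)                ≡⟨ regroup (q ^ℚ (r C 2)) (invFact r) t (Δ (suc m) r q) ⟩
    (1ℚ - t) * invFact r * q ^ℚ (r C 2) * Δ (suc m) r q ∎
    where
    t = q ^ℚ r
    H = hSeries (εSeries q)
    c : ℕ → ℚ
    c i = qInt (suc i) t * ε (suc i) q
    determinant : Δ (suc m) r q ≡ (alternate c ⊛ H) m
    determinant = trans (det-cong (suc m) (matA (suc m) r q) (εMatrix (suc m) c q) same-entries) (det-εMatrix q m c)
      where
      same-entries : ∀ i j → matA (suc m) r q i j ≡ εMatrix (suc m) c q i j
      same-entries i zero    = refl
      same-entries i (suc j) = refl
    regroup : ∀ a b t d → a * b * ((1ℚ - t) * d) ≡ (1ℚ - t) * b * a * d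
    regroup = solve-∀ ℚ-ring

open import Defs
open import Data.Nat using (ℕ; _≤_; _+_; _∸_)
open import Data.Nat.Combinatorics using (_C_)
open import Data.Rational using (ℚ; 1ℚ; _*_; _-_)
open import Data.Vec using (Vec)
open import Relation.Binary.PropositionalEquality using (_≡_)

open import Data.Nat using (suc)
open import Data.Nat.Properties using (m≤n⇒∃[o]m+o≡n; +-assoc; m+n∸m≡n)
open import Data.Product using (_,_)
open import Relation.Binary.PropositionalEquality using (refl; cong; trans; module ≡-Reasoning)
open RestrictedSums using (Q)
open Specialization using (εSeries; Q-εSeries)
open AlgebraicIndependence using (evalPoly-Q)
open ≡-Reasoning

lemma6p1 : (n r : ℕ) → 1 ≤ r → r + 1 ≤ n →
    (P : Poly n) →
    (∀ (N : ℕ) (x : Vec ℚ N) → evalPoly P (eVec n x) ≡ p n r x) →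
    (q : ℚ) →
    evalPoly P (εVec n q)
      ≡ (1ℚ - q ^ℚ r) * invFact r * q ^ℚ (r C 2) * Δ (n ∸ r) r q
lemma6p1 n r _ r+1≤n P P≡p q with m , refl ← m≤n⇒∃[o]m+o≡n r+1≤n = begin
  evalPoly P (εVec (r + 1 + m) q)                          ≡⟨ evalPoly-Q (r + 1 + m) r P P≡p (εSeries q) refl ⟩
  Q r (εSeries q) (r + 1 + m)                              ≡⟨ cong (Q r (εSeries q)) (+-assoc r 1 m) ⟩
  Q r (εSeries q) (r + suc m)                              ≡⟨ Q-εSeries q r m ⟩
  (1ℚ - q ^ℚ r) * invFact r * q ^ℚ (r C 2) * Δ (suc m) r q ≡⟨ cong (λ k → (1ℚ - q ^ℚ r) * invFact r * q ^ℚ (r C 2) * Δ k r q) n∸r≡1+m ⟨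
  (1ℚ - q ^ℚ r) * invFact r * q ^ℚ (r C 2) * Δ (r + 1 + m ∸ r) r q ∎
  where
  n∸r≡1+m : r + 1 + m ∸ r ≡ suc m
  n∸r≡1+m = trans (cong (_∸ r) (+-assoc r 1 m)) (m+n∸m≡n r (suc m))
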